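{- Let $q>2$ be a prime power and let $K\subseteq A_n=GF(q)[x]/(x^n-1)$ be the minimal ideal with parity-check polynomial $h$ irreducible over $GF(q)$ of degree $m$ and order $n$, where $\gcd(n,q)=1$ and $n\ne q^m-1$. Then the Hamming weight of every element of $K$ is a multiple of $d=\gcd(q-1,n)$.
   Context: $K$ is the ideal generated by $(x^n-1)/h(x)$. The order of $h$ is the least $e\ge1$ with $h\mid x^e-1$. The Hamming weight of an element of $A_n$ is the number of nonzero coefficients of its representative of degree $<n$. -}

module Defs where

open import Level using (0ℓ)
open import Data.Nat as ℕ using (ℕ; zero; suc; _<_; _≤_)
open import Data.Nat.Primality using (Prime)
open import Data.Fin using (Fin)
open import Data.List using (List; []; _∷_; replicate; _++_; [_])
open import Data.Vec using (Vec; toList; count)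
open import Data.Product using (Σ; ∃; _×_; _,_)
open import Data.Sum using (_⊎_)
open import Relation.Nullary using (¬_; Dec)
open import Relation.Binary.PropositionalEquality using (_≡_; _≢_)
open import Function.Bundles using (_↔_)
open import Algebra.Structures using (IsCommutativeRing)

IsPrimePower : ℕ → Set
IsPrimePower q = Σ ℕ λ p → Σ ℕ λ k → Prime p × 1 ≤ k × q ≡ p ℕ.^ k

-- A finite field with exactly q elements (i.e. GF(q), unique up to isomorphism).
-- Equality is propositional; decidable equality is included (automatic for finite fields).
record FiniteField (q : ℕ) : Set₁ where
  field
    Carrier : Set
    _+_ _*_ : Carrier → Carrier → Carrier
    -_      : Carrier → Carrier
    0# 1#   : Carrier
    isCommutativeRing : IsCommutativeRing _≡_ _+_ _*_ -_ 0# 1#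
    0≢1     : 0# ≢ 1#
    inverse : ∀ x → x ≢ 0# → Σ Carrier λ y → x * y ≡ 1#
    _≟_     : (x y : Carrier) → Dec (x ≡ y)
    card    : Carrier ↔ Fin q

module Poly {q : ℕ} (F : FiniteField q) where
  open FiniteField F

  -- polynomials over F as coefficient lists, constant term first
  Pol : Set
  Pol = List Carrier

  coeff : Pol → ℕ → Carrier
  coeff []      _       = 0#
  coeff (a ∷ p) zero    = a
  coeff (a ∷ p) (suc i) = coeff p i

  -- polynomial equality: equal coefficients (trailing zeros irrelevant)
  _≈ₚ_ : Pol → Pol → Set
  p ≈ₚ r = ∀ i → coeff p i ≡ coeff r i

  addP : Pol → Pol → Pol
  addP []      r       = r
  addP p       []      = p
  addP (a ∷ p) (b ∷ r) = (a + b) ∷ addP p r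

  negP : Pol → Pol
  negP []      = []
  negP (a ∷ p) = (- a) ∷ negP p

  subP : Pol → Pol → Pol
  subP p r = addP p (negP r)

  scaleP : Carrier → Pol → Pol
  scaleP c []      = []
  scaleP c (a ∷ p) = (c * a) ∷ scaleP c p

  mulP : Pol → Pol → Pol
  mulP []      r = []
  mulP (a ∷ p) r = addP (scaleP a r) (0# ∷ mulP p r)

  oneP : Pol
  oneP = [ 1# ]

  monomial : ℕ → Pol
  monomial e = replicate e 0# ++ [ 1# ]

  xᵉ-1 : ℕ → Pol
  xᵉ-1 e = subP (monomial e) oneP

  _∣ₚ_ : Pol → Pol → Set
  f ∣ₚ g = Σ Pol λ k → mulP k f ≈ₚ g

  IsUnit : Pol → Set
  IsUnit p = Σ Pol λ u → mulP u p ≈ₚ oneP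

  HasDegree : Pol → ℕ → Set
  HasDegree p m = coeff p m ≢ 0# × (∀ i → m < i → coeff p i ≡ 0#)

  Irreducible : Pol → Set
  Irreducible h = ¬ (h ≈ₚ []) × ¬ IsUnit h ×
                  (∀ a b → mulP a b ≈ₚ h → IsUnit a ⊎ IsUnit b)

  HasOrder : Pol → ℕ → Set
  HasOrder h e = 1 ≤ e × h ∣ₚ xᵉ-1 e × (∀ e′ → 1 ≤ e′ → h ∣ₚ xᵉ-1 e′ → e ≤ e′)

  -- elements of A_n = F[x]/(x^n - 1), given by their representative of degree < n
  Aₙ : ℕ → Set
  Aₙ n = Vec Carrier n

  rep : ∀ {n} → Aₙ n → Pol
  rep c = toList c

  InIdeal : (n : ℕ) → Pol → Aₙ n → Set
  InIdeal n g c = Σ Pol λ a → xᵉ-1 n ∣ₚ subP (mulP a g) (rep c)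

  weight : ∀ {n} → Aₙ n → ℕ
  weight c = count (λ x → Relation.Nullary.¬? (x ≟ 0#)) c

{-# OPTIONS --safe #-}
module Submission where

-- Put d = gcd(q - 1, n), n = t·d and q - 1 = s·d. Modulo h, which divides xⁿ - 1, the element y = xᵗ
-- satisfies yᵠ = y·(xⁿ)ˢ ≡ y. Since yᵠ - y is a constant multiple of ∏_{a ∈ F} (y - a) (Fermat's little
-- theorem) and the irreducible h is prime, h ∣ xᵗ - a for some a ∈ F. Every c ∈ (g) is annihilated by h
-- modulo xⁿ - 1 = g·h, so (xᵗ - a)·c ≡ 0, i.e. c_j = a·c_{j+t} with indices mod n. Hence the zero pattern
-- of c has period t, and its weight is d times the number of nonzero coefficients among c_0, …, c_{t-1}.

open import Level using (0ℓ)
open import Data.Nat as ℕ using (ℕ; zero; suc; _≤_; _<_; _∸_; z≤n; s≤s; _%_)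
import Data.Nat.Properties as ℕₚ
import Data.Nat.DivMod as ℕ%
import Data.Nat.Divisibility as ℕᵈ
open import Data.Nat.GCD using (gcd; gcd[m,n]∣m; gcd[m,n]∣n)
open import Data.Fin using (Fin; zero; suc)
import Data.Fin.Properties as Finₚ
open import Data.Fin.Permutation using (Permutation; permutation)
open import Data.Vec as Vec using (toList)
import Data.Vec.Properties as Vecₚ
open import Data.List using (List; []; _∷_; [_]; length; tabulate)
open import Data.List.Properties using (length-tabulate)
open import Data.List.Relation.Unary.All as All using (All; []; _∷_)
open import Data.List.Relation.Unary.AllPairs using ([]; _∷_)
open import Data.List.Relation.Unary.Unique.Propositional using (Unique)
import Data.List.Relation.Unary.Unique.Propositional.Properties as Uniqueₚ
open import Data.Product using (Σ; _×_; _,_; proj₁; proj₂)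
open import Data.Sum using (_⊎_; inj₁; inj₂)
open import Data.Empty using (⊥-elim)
open import Function using (_∘_; id; Inverse)
open import Relation.Nullary using (¬_; yes; no)
open import Relation.Binary.PropositionalEquality using (_≡_; _≢_; refl; sym; trans; cong; cong₂; subst; module ≡-Reasoning)
import Relation.Binary.Reasoning.Setoid
open import Algebra.Bundles using (CommutativeRing)
open import Algebra.Morphism.Structures using (IsRingHomomorphism)
import Algebra.Morphism.Construct.Identity as Identity
import Algebra.Properties.Ring as RingProperties
import Algebra.Properties.CommutativeSemigroup as CommutativeSemigroupProperties
import Algebra.Properties.CommutativeMonoid.Sum as SumProperties
import Algebra.Solver.Ring.NaturalCoefficients.Default as SemiringSolver

open import Defs

module IrreducibleCyclicCodes {q : ℕ} (F : FiniteField q) where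
  open FiniteField F using (Carrier; isCommutativeRing; 0≢1; inverse; _≟_; card)

  field-commutativeRing : CommutativeRing 0ℓ 0ℓ
  field-commutativeRing = record { isCommutativeRing = isCommutativeRing }

  open CommutativeRing field-commutativeRing
    using (_+_; _*_; -_; 0#; 1#; +-comm; +-identityˡ; +-identityʳ; -‿inverseʳ; *-comm; *-assoc; *-identityˡ; *-identityʳ; zeroˡ; zeroʳ; distribˡ; distribʳ)
  module Fₚ = RingProperties (CommutativeRing.ring field-commutativeRing)
  open SemiringSolver (CommutativeRing.commutativeSemiring field-commutativeRing) using (solve; _:+_; _:*_; _:=_)

  x*y≡0⇒x≡0⊎y≡0 : ∀ x y → x * y ≡ 0# → x ≡ 0# ⊎ y ≡ 0#
  x*y≡0⇒x≡0⊎y≡0 x y xy≡0 with x ≟ 0#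
  ... | yes x≡0 = inj₁ x≡0
  ... | no x≢0 = inj₂ (begin
    y               ≡⟨ sym (*-identityˡ y) ⟩
    1# * y          ≡⟨ cong (_* y) (sym x⁻¹x) ⟩
    (x⁻¹ * x) * y   ≡⟨ *-assoc x⁻¹ x y ⟩
    x⁻¹ * (x * y)   ≡⟨ cong (x⁻¹ *_) xy≡0 ⟩
    x⁻¹ * 0#        ≡⟨ zeroʳ x⁻¹ ⟩
    0#              ∎)
    where
    open ≡-Reasoning
    x⁻¹ = proj₁ (inverse x x≢0)
    x⁻¹x : x⁻¹ * x ≡ 1#
    x⁻¹x = trans (*-comm x⁻¹ x) (proj₂ (inverse x x≢0))

  x≢0∧y≢0⇒x*y≢0 : ∀ {x y} → x ≢ 0# → y ≢ 0# → x * y ≢ 0#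
  x≢0∧y≢0⇒x*y≢0 {x} {y} x≢0 y≢0 xy≡0 with x*y≡0⇒x≡0⊎y≡0 x y xy≡0
  ... | inj₁ x≡0 = x≢0 x≡0
  ... | inj₂ y≡0 = y≢0 y≡0

  enum : Fin q → Carrier
  enum = Inverse.from card

  index : Carrier → Fin q
  index = Inverse.to card

  enum-index : ∀ x → enum (index x) ≡ x
  enum-index = Inverse.strictlyInverseʳ card

  index-enum : ∀ i → index (enum i) ≡ i
  index-enum = Inverse.strictlyInverseˡ card

  index-injective : ∀ {x y} → index x ≡ index y → x ≡ y
  index-injective {x} {y} eq = trans (sym (enum-index x)) (trans (cong enum eq) (enum-index y))

  *-cancelʳ-nonZero : ∀ {x y z} → z ≢ 0# → x * z ≡ y * z → x ≡ y
  *-cancelʳ-nonZero {x} {y} {z} z≢0 xz≡yz with x*y≡0⇒x≡0⊎y≡0 (x + - y) z [x-y]z≡0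
    where
    [x-y]z≡0 : (x + - y) * z ≡ 0#
    [x-y]z≡0 = trans (Fₚ.[y-z]x≈yx-zx z x y) (trans (cong (_+ - (y * z)) xz≡yz) (-‿inverseʳ (y * z)))
  ... | inj₁ x-y≡0 = Fₚ.x∙y⁻¹≈ε⇒x≈y x y x-y≡0
  ... | inj₂ z≡0   = ⊥-elim (z≢0 z≡0)

  2≤q : 2 ≤ q
  2≤q = distinct⇒2≤ (index 0#) (index 1#) (0≢1 ∘ index-injective)
    where
    distinct⇒2≤ : ∀ {m} (i j : Fin m) → i ≢ j → 2 ≤ m
    distinct⇒2≤ {suc zero} zero zero i≢j = ⊥-elim (i≢j refl)
    distinct⇒2≤ {suc (suc m)} _ _ _ = s≤s (s≤s z≤n)


  open import Algebra.Properties.Semiring.Exp (CommutativeRing.semiring field-commutativeRing) using (_^_)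
  module Π = SumProperties (CommutativeRing.*-commutativeMonoid field-commutativeRing)
  open Π using () renaming (sum to ∏)

  ∏-ones : ∀ {n} (f : Fin n → Carrier) → (∀ i → f i ≡ 1#) → ∏ f ≡ 1#
  ∏-ones {zero}  f f≡1 = refl
  ∏-ones {suc n} f f≡1 = trans (cong₂ _*_ (f≡1 zero) (∏-ones (f ∘ suc) (f≡1 ∘ suc))) (*-identityʳ 1#)

  ∏-single : ∀ {n} (k : Fin n) (f : Fin n → Carrier) → (∀ i → i ≢ k → f i ≡ 1#) → ∏ f ≡ f k
  ∏-single zero    f f≡1 = trans (cong (f zero *_) (∏-ones (f ∘ suc) (λ i → f≡1 (suc i) (λ ())))) (*-identityʳ _)
  ∏-single (suc k) f f≡1 =
    trans (cong (_* ∏ (f ∘ suc)) (f≡1 zero (λ ()))) (trans (*-identityˡ _) (∏-single k (f ∘ suc) (λ i i≢k → f≡1 (suc i) (i≢k ∘ Finₚ.suc-injective))))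

  ∏-nonZero : ∀ {n} (f : Fin n → Carrier) → (∀ i → f i ≢ 0#) → ∏ f ≢ 0#
  ∏-nonZero {zero}  f f≢0 = 0≢1 ∘ sym
  ∏-nonZero {suc n} f f≢0 = x≢0∧y≢0⇒x*y≢0 (f≢0 zero) (∏-nonZero (f ∘ suc) (f≢0 ∘ suc))

  ∏-scaled : ∀ {a} → a ≢ 0# → (f : Carrier → Carrier) → ∏ (λ i → f (a * enum i)) ≡ ∏ (f ∘ enum)
  ∏-scaled {a} a≢0 f = trans (Π.sum-cong-≗ (λ i → cong f (sym (enum-index (a * enum i))))) (sym (Π.∑-permute (f ∘ enum) scaling))
    where
    a⁻¹ = proj₁ (inverse a a≢0)
    cancel : ∀ {x y} → x * y ≡ 1# → ∀ i → index (x * enum (index (y * enum i))) ≡ i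
    cancel {x} {y} xy≡1 i = begin
      index (x * enum (index (y * enum i)))  ≡⟨ cong (λ z → index (x * z)) (enum-index (y * enum i)) ⟩
      index (x * (y * enum i))               ≡⟨ cong index (sym (*-assoc x y (enum i))) ⟩
      index (x * y * enum i)                 ≡⟨ cong (λ z → index (z * enum i)) xy≡1 ⟩
      index (1# * enum i)                    ≡⟨ cong index (*-identityˡ (enum i)) ⟩
      index (enum i)                         ≡⟨ index-enum i ⟩
      i                                      ∎
      where open ≡-Reasoning
    scaling : Permutation q q
    scaling = permutation (λ i → index (a * enum i)) (λ i → index (a⁻¹ * enum i))
      (cancel (proj₂ (inverse a a≢0))) (cancel (trans (*-comm a⁻¹ a) (proj₂ (inverse a a≢0))))

  -- Multiplication by a ≠ 0 permutes F. With x′ the element x with 0 replaced by 1, a·x′ = (a x)′·ψ x where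
  -- ψ x = a if x = 0 and 1 otherwise; taking products over F gives aᵠ·P = P·a with P = ∏ x′ ≠ 0.
  fermat : ∀ a → a ^ q ≡ a
  fermat a with a ≟ 0#
  ... | yes refl = 0^q≡0 q 2≤q
    where
    0^q≡0 : ∀ m → 2 ≤ m → 0# ^ m ≡ 0#
    0^q≡0 (suc m) _ = zeroˡ _
  ... | no a≢0 = *-cancelʳ-nonZero P≢0 (begin
    a ^ q * P                                ≡⟨ cong (_* P) (Π.sum-replicate q) ⟨
    ∏ {q} (λ _ → a) * P                      ≡⟨ Π.∑-distrib-+ (λ _ → a) (λ i → x′ (enum i)) ⟨
    ∏ (λ i → a * x′ (enum i))                ≡⟨ Π.sum-cong-≗ (λ i → scale-x′ (enum i)) ⟩
    ∏ (λ i → x′ (a * enum i) * ψ (enum i))   ≡⟨ Π.∑-distrib-+ (λ i → x′ (a * enum i)) (λ i → ψ (enum i)) ⟩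
    ∏ (λ i → x′ (a * enum i)) * ∏ (ψ ∘ enum) ≡⟨ cong₂ _*_ (∏-scaled a≢0 x′) ∏ψ≡a ⟩
    P * a                                    ≡⟨ *-comm P a ⟩
    a * P                                    ∎)
    where
    open ≡-Reasoning
    x′ : Carrier → Carrier
    x′ x with x ≟ 0#
    ... | yes _ = 1#
    ... | no _  = x
    P = ∏ (x′ ∘ enum)
    P≢0 : P ≢ 0#
    P≢0 = ∏-nonZero (x′ ∘ enum) λ i → x′≢0 (enum i)
      where
      x′≢0 : ∀ x → x′ x ≢ 0#
      x′≢0 x with x ≟ 0#
      ... | yes _   = 0≢1 ∘ sym
      ... | no x≢0 = x≢0
    ψ : Carrier → Carrier
    ψ x with x ≟ 0#
    ... | yes _ = a
    ... | no _  = 1#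
    scale-x′ : ∀ x → a * x′ x ≡ x′ (a * x) * ψ x
    scale-x′ x with x ≟ 0#
    ... | yes refl with (a * 0#) ≟ 0#
    ...   | yes _  = *-comm a 1#
    ...   | no a0≢0 = ⊥-elim (a0≢0 (zeroʳ a))
    scale-x′ x | no x≢0 with (a * x) ≟ 0#
    ...   | yes ax≡0 = ⊥-elim (x≢0∧y≢0⇒x*y≢0 a≢0 x≢0 ax≡0)
    ...   | no _     = sym (*-identityʳ _)
    ∏ψ≡a : ∏ (ψ ∘ enum) ≡ a
    ∏ψ≡a = trans (∏-single (index 0#) (ψ ∘ enum) ψ≡1) (trans (cong ψ (enum-index 0#)) ψ0≡a)
      where
      ψ0≡a : ψ 0# ≡ a
      ψ0≡a with 0# ≟ 0#
      ... | yes _   = refl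
      ... | no 0≢0 = ⊥-elim (0≢0 refl)
      ψ≡1 : ∀ i → i ≢ index 0# → ψ (enum i) ≡ 1#
      ψ≡1 i i≢0 with enum i ≟ 0#
      ... | yes i≡0 = ⊥-elim (i≢0 (trans (sym (index-enum i)) (cong index i≡0)))
      ... | no _    = refl

  open Poly F

  coeff-addP : ∀ p r i → coeff (addP p r) i ≡ coeff p i + coeff r i
  coeff-addP []      r       i       = sym (+-identityˡ _)
  coeff-addP (a ∷ p) []      i       = sym (+-identityʳ _)
  coeff-addP (a ∷ p) (b ∷ r) zero    = refl
  coeff-addP (a ∷ p) (b ∷ r) (suc i) = coeff-addP p r i

  coeff-negP : ∀ p i → coeff (negP p) i ≡ - coeff p i
  coeff-negP []      i       = sym Fₚ.-0#≈0#
  coeff-negP (a ∷ p) zero    = refl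
  coeff-negP (a ∷ p) (suc i) = coeff-negP p i

  coeff-scaleP : ∀ c p i → coeff (scaleP c p) i ≡ c * coeff p i
  coeff-scaleP c []      i       = sym (zeroʳ c)
  coeff-scaleP c (a ∷ p) zero    = refl
  coeff-scaleP c (a ∷ p) (suc i) = coeff-scaleP c p i

  coeff-subP : ∀ p r i → coeff (subP p r) i ≡ coeff p i + - coeff r i
  coeff-subP p r i = trans (coeff-addP p (negP r) i) (cong (coeff p i +_) (coeff-negP r i))

  -- A record rather than Defs' _≈ₚ_, so that both polynomials can be inferred from a proof.
  infix 4 _≈_
  record _≈_ (p r : Pol) : Set where
    constructor coeffwise
    field at : p ≈ₚ r
  open _≈_

  ≈-refl : ∀ {p} → p ≈ p
  ≈-refl = coeffwise (λ i → refl)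

  ≈-sym : ∀ {p r} → p ≈ r → r ≈ p
  ≈-sym p≈r = coeffwise (λ i → sym (at p≈r i))

  ≈-trans : ∀ {p r s} → p ≈ r → r ≈ s → p ≈ s
  ≈-trans p≈r r≈s = coeffwise (λ i → trans (at p≈r i) (at r≈s i))

  ∷-cong : ∀ {a b p r} → a ≡ b → p ≈ r → (a ∷ p) ≈ (b ∷ r)
  ∷-cong a≡b p≈r = coeffwise (λ { zero → a≡b ; (suc i) → at p≈r i })

  ∷-zero : ∀ {p} → p ≈ [] → (0# ∷ p) ≈ []
  ∷-zero p≈[] = coeffwise (λ { zero → refl ; (suc i) → at p≈[] i })

  addP-cong : ∀ {p p′ r r′} → p ≈ p′ → r ≈ r′ → addP p r ≈ addP p′ r′
  addP-cong {p} {p′} {r} {r′} p≈p′ r≈r′ = coeffwise (λ i → begin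
    coeff (addP p r) i        ≡⟨ coeff-addP p r i ⟩
    coeff p i + coeff r i     ≡⟨ cong₂ _+_ (at p≈p′ i) (at r≈r′ i) ⟩
    coeff p′ i + coeff r′ i   ≡⟨ coeff-addP p′ r′ i ⟨
    coeff (addP p′ r′) i      ∎)
    where open ≡-Reasoning

  addP-congʳ : ∀ p {r r′} → r ≈ r′ → addP p r ≈ addP p r′
  addP-congʳ p = addP-cong (≈-refl {p})

  negP-cong : ∀ {p p′} → p ≈ p′ → negP p ≈ negP p′
  negP-cong {p} {p′} p≈p′ = coeffwise (λ i → trans (coeff-negP p i) (trans (cong -_ (at p≈p′ i)) (sym (coeff-negP p′ i))))

  scaleP-cong : ∀ {c d p p′} → c ≡ d → p ≈ p′ → scaleP c p ≈ scaleP d p′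
  scaleP-cong {c} {d} {p} {p′} c≡d p≈p′ =
    coeffwise (λ i → trans (coeff-scaleP c p i) (trans (cong₂ _*_ c≡d (at p≈p′ i)) (sym (coeff-scaleP d p′ i))))

  subP-cong : ∀ {p p′ r r′} → p ≈ p′ → r ≈ r′ → subP p r ≈ subP p′ r′
  subP-cong p≈p′ r≈r′ = addP-cong p≈p′ (negP-cong r≈r′)

  addP-comm : ∀ p r → addP p r ≈ addP r p
  addP-comm p r = coeffwise (λ i → trans (coeff-addP p r i) (trans (+-comm _ _) (sym (coeff-addP r p i))))

  addP-assoc : ∀ p r s → addP (addP p r) s ≈ addP p (addP r s)
  addP-assoc p r s = coeffwise (λ i → begin
    coeff (addP (addP p r) s) i              ≡⟨ coeff-addP (addP p r) s i ⟩
    coeff (addP p r) i + coeff s i           ≡⟨ cong (_+ coeff s i) (coeff-addP p r i) ⟩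
    (coeff p i + coeff r i) + coeff s i      ≡⟨ CommutativeRing.+-assoc field-commutativeRing _ _ _ ⟩
    coeff p i + (coeff r i + coeff s i)      ≡⟨ cong (coeff p i +_) (coeff-addP r s i) ⟨
    coeff p i + coeff (addP r s) i           ≡⟨ coeff-addP p (addP r s) i ⟨
    coeff (addP p (addP r s)) i              ∎)
    where open ≡-Reasoning

  addP-identityʳ : ∀ p → addP p [] ≈ p
  addP-identityʳ p = coeffwise (λ i → trans (coeff-addP p [] i) (+-identityʳ _))

  addP-inverseʳ : ∀ p → addP p (negP p) ≈ []
  addP-inverseʳ p = coeffwise (λ i → trans (coeff-subP p p i) (-‿inverseʳ (coeff p i)))

  addP-inverseˡ : ∀ p → addP (negP p) p ≈ []
  addP-inverseˡ p = ≈-trans (addP-comm (negP p) p) (addP-inverseʳ p)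

  addP-interchange : ∀ w x y z → addP (addP w x) (addP y z) ≈ addP (addP w y) (addP x z)
  addP-interchange w x y z = coeffwise (λ i →
    trans (coeff-addP (addP w x) (addP y z) i) (trans (cong₂ _+_ (coeff-addP w x i) (coeff-addP y z i))
    (trans (solve 4 (λ w x y z → (w :+ x) :+ (y :+ z) := (w :+ y) :+ (x :+ z)) refl (coeff w i) (coeff x i) (coeff y i) (coeff z i))
    (sym (trans (coeff-addP (addP w y) (addP x z) i) (cong₂ _+_ (coeff-addP w y i) (coeff-addP x z i)))))))

  0∷-addP : ∀ p r → (0# ∷ addP p r) ≈ addP (0# ∷ p) (0# ∷ r)
  0∷-addP p r = ∷-cong (sym (+-identityʳ 0#)) ≈-refl

  0∷-scaleP : ∀ c p → (0# ∷ scaleP c p) ≈ scaleP c (0# ∷ p)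
  0∷-scaleP c p = ∷-cong (sym (zeroʳ c)) ≈-refl

  scaleP-zero : ∀ p → scaleP 0# p ≈ []
  scaleP-zero p = coeffwise (λ i → trans (coeff-scaleP 0# p i) (zeroˡ _))

  scaleP-identity : ∀ p → scaleP 1# p ≈ p
  scaleP-identity p = coeffwise (λ i → trans (coeff-scaleP 1# p i) (*-identityˡ _))

  scaleP-distribˡ : ∀ c p r → scaleP c (addP p r) ≈ addP (scaleP c p) (scaleP c r)
  scaleP-distribˡ c p r = coeffwise (λ i → begin
    coeff (scaleP c (addP p r)) i                ≡⟨ coeff-scaleP c (addP p r) i ⟩
    c * coeff (addP p r) i                       ≡⟨ cong (c *_) (coeff-addP p r i) ⟩
    c * (coeff p i + coeff r i)                  ≡⟨ distribˡ c _ _ ⟩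
    c * coeff p i + c * coeff r i                ≡⟨ cong₂ _+_ (coeff-scaleP c p i) (coeff-scaleP c r i) ⟨
    coeff (scaleP c p) i + coeff (scaleP c r) i  ≡⟨ coeff-addP (scaleP c p) (scaleP c r) i ⟨
    coeff (addP (scaleP c p) (scaleP c r)) i     ∎)
    where open ≡-Reasoning

  scaleP-distribʳ : ∀ c d p → scaleP (c + d) p ≈ addP (scaleP c p) (scaleP d p)
  scaleP-distribʳ c d p = coeffwise (λ i → begin
    coeff (scaleP (c + d) p) i                   ≡⟨ coeff-scaleP (c + d) p i ⟩
    (c + d) * coeff p i                          ≡⟨ distribʳ (coeff p i) c d ⟩
    c * coeff p i + d * coeff p i                ≡⟨ cong₂ _+_ (coeff-scaleP c p i) (coeff-scaleP d p i) ⟨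
    coeff (scaleP c p) i + coeff (scaleP d p) i  ≡⟨ coeff-addP (scaleP c p) (scaleP d p) i ⟨
    coeff (addP (scaleP c p) (scaleP d p)) i     ∎)
    where open ≡-Reasoning

  scaleP-assoc : ∀ c d p → scaleP c (scaleP d p) ≈ scaleP (c * d) p
  scaleP-assoc c d p = coeffwise (λ i → begin
    coeff (scaleP c (scaleP d p)) i  ≡⟨ coeff-scaleP c (scaleP d p) i ⟩
    c * coeff (scaleP d p) i         ≡⟨ cong (c *_) (coeff-scaleP d p i) ⟩
    c * (d * coeff p i)              ≡⟨ *-assoc c d _ ⟨
    c * d * coeff p i                ≡⟨ coeff-scaleP (c * d) p i ⟨
    coeff (scaleP (c * d) p) i       ∎)
    where open ≡-Reasoning

  mulP-zeroʳ : ∀ p → mulP p [] ≈ []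
  mulP-zeroʳ []      = ≈-refl
  mulP-zeroʳ (a ∷ p) = ∷-zero (mulP-zeroʳ p)

  mulP-congʳ : ∀ p {r r′} → r ≈ r′ → mulP p r ≈ mulP p r′
  mulP-congʳ []      r≈r′ = ≈-refl
  mulP-congʳ (a ∷ p) r≈r′ = addP-cong (scaleP-cong refl r≈r′) (∷-cong refl (mulP-congʳ p r≈r′))

  mulP-0∷ : ∀ p r → mulP (0# ∷ p) r ≈ (0# ∷ mulP p r)
  mulP-0∷ p r = addP-cong (scaleP-zero r) ≈-refl

  mulP-distribʳ : ∀ p p′ r → mulP (addP p p′) r ≈ addP (mulP p r) (mulP p′ r)
  mulP-distribʳ []      p′       r = ≈-refl
  mulP-distribʳ (a ∷ p) []       r = ≈-sym (addP-identityʳ _)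
  mulP-distribʳ (a ∷ p) (b ∷ p′) r =
    ≈-trans (addP-cong (scaleP-distribʳ a b r) (≈-trans (∷-cong refl (mulP-distribʳ p p′ r)) (0∷-addP (mulP p r) (mulP p′ r))))
            (addP-interchange (scaleP a r) (scaleP b r) (0# ∷ mulP p r) (0# ∷ mulP p′ r))

  mulP-scaleP : ∀ c p r → mulP (scaleP c p) r ≈ scaleP c (mulP p r)
  mulP-scaleP c []      r = ≈-refl
  mulP-scaleP c (a ∷ p) r =
    ≈-trans (addP-cong (≈-sym (scaleP-assoc c a r)) (≈-trans (∷-cong refl (mulP-scaleP c p r)) (0∷-scaleP c (mulP p r))))
            (≈-sym (scaleP-distribˡ c (scaleP a r) (0# ∷ mulP p r)))

  mulP-∷ʳ : ∀ p b r → mulP p (b ∷ r) ≈ addP (scaleP b p) (0# ∷ mulP p r)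
  mulP-∷ʳ []      b r = ≈-sym (∷-zero ≈-refl)
  mulP-∷ʳ (a ∷ p) b r = ∷-cong head-eq (≈-trans (addP-congʳ (scaleP a r) (mulP-∷ʳ p b r)) (swap (scaleP a r) (scaleP b p) (0# ∷ mulP p r)))
    where
    head-eq : a * b + 0# ≡ b * a + 0#
    head-eq = cong (_+ 0#) (*-comm a b)
    swap : ∀ x y z → addP x (addP y z) ≈ addP y (addP x z)
    swap x y z = coeffwise (λ i → trans (coeff-addP x (addP y z) i) (trans (cong (_ +_) (coeff-addP y z i))
      (trans (solve 3 (λ x y z → x :+ (y :+ z) := y :+ (x :+ z)) refl (coeff x i) (coeff y i) (coeff z i))
      (sym (trans (coeff-addP y (addP x z) i) (cong (_ +_) (coeff-addP x z i)))))))

  mulP-comm : ∀ p r → mulP p r ≈ mulP r p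
  mulP-comm []      r = ≈-sym (mulP-zeroʳ r)
  mulP-comm (a ∷ p) r = ≈-trans (addP-congʳ (scaleP a r) (∷-cong refl (mulP-comm p r))) (≈-sym (mulP-∷ʳ r a p))

  mulP-congˡ : ∀ {p p′} r → p ≈ p′ → mulP p r ≈ mulP p′ r
  mulP-congˡ {p} {p′} r p≈p′ = ≈-trans (mulP-comm p r) (≈-trans (mulP-congʳ r p≈p′) (mulP-comm r p′))

  mulP-cong : ∀ {p p′ r r′} → p ≈ p′ → r ≈ r′ → mulP p r ≈ mulP p′ r′
  mulP-cong {p′ = p′} {r = r} p≈p′ r≈r′ = ≈-trans (mulP-congˡ r p≈p′) (mulP-congʳ p′ r≈r′)

  mulP-distribˡ : ∀ p r r′ → mulP p (addP r r′) ≈ addP (mulP p r) (mulP p r′)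
  mulP-distribˡ p r r′ =
    ≈-trans (mulP-comm p (addP r r′)) (≈-trans (mulP-distribʳ r r′ p) (addP-cong (mulP-comm r p) (mulP-comm r′ p)))

  mulP-assoc : ∀ p r s → mulP (mulP p r) s ≈ mulP p (mulP r s)
  mulP-assoc []      r s = ≈-refl
  mulP-assoc (a ∷ p) r s = ≈-trans (mulP-distribʳ (scaleP a r) (0# ∷ mulP p r) s)
    (addP-cong (mulP-scaleP a r s) (≈-trans (mulP-0∷ (mulP p r) s) (∷-cong refl (mulP-assoc p r s))))

  mulP-identityˡ : ∀ p → mulP oneP p ≈ p
  mulP-identityˡ p = ≈-trans (addP-cong (scaleP-identity p) (∷-zero ≈-refl)) (addP-identityʳ p)

  mulP-identityʳ : ∀ p → mulP p oneP ≈ p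
  mulP-identityʳ p = ≈-trans (mulP-comm p oneP) (mulP-identityˡ p)

  polynomial-commutativeRing : CommutativeRing 0ℓ 0ℓ
  polynomial-commutativeRing = record
    { Carrier = Pol ; _≈_ = _≈_ ; _+_ = addP ; _*_ = mulP ; -_ = negP ; 0# = [] ; 1# = oneP
    ; isCommutativeRing = record
      { isRing = record
        { +-isAbelianGroup = record
          { isGroup = record
            { isMonoid = record
              { isSemigroup = record
                { isMagma = record
                  { isEquivalence = record { refl = ≈-refl ; sym = ≈-sym ; trans = ≈-trans }
                  ; ∙-cong = addP-cong }
                ; assoc = addP-assoc }
              ; identity = (λ _ → ≈-refl) , addP-identityʳ }
            ; inverse = addP-inverseˡ , addP-inverseʳ
            ; ⁻¹-cong = negP-cong }
          ; comm = addP-comm }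
        ; *-cong = mulP-cong
        ; *-assoc = mulP-assoc
        ; *-identity = mulP-identityˡ , mulP-identityʳ
        ; distrib = mulP-distribˡ , λ r p p′ → mulP-distribʳ p p′ r }
      ; *-comm = mulP-comm } }

  module Polₚ = RingProperties (CommutativeRing.ring polynomial-commutativeRing)
  module ≈-Reasoning = Relation.Binary.Reasoning.Setoid (CommutativeRing.setoid polynomial-commutativeRing)
  open SemiringSolver (CommutativeRing.commutativeSemiring polynomial-commutativeRing) using ()
    renaming (solve to solveᴾ; _:+_ to _⊕_; _:*_ to _⊗_; _:=_ to _⊜_)

  infix 4 _∣_
  _∣_ : Pol → Pol → Set
  f ∣ g = Σ Pol λ k → mulP k f ≈ g

  ∣-respʳ : ∀ {f g g′} → g ≈ g′ → f ∣ g → f ∣ g′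
  ∣-respʳ g≈g′ (k , kf≈g) = k , ≈-trans kf≈g g≈g′

  ∣-refl : ∀ f → f ∣ f
  ∣-refl f = oneP , mulP-identityˡ f

  ∣-trans : ∀ {f g h} → f ∣ g → g ∣ h → f ∣ h
  ∣-trans {f} (k , kf≈g) (l , lg≈h) = mulP l k , ≈-trans (mulP-assoc l k f) (≈-trans (mulP-congʳ l kf≈g) lg≈h)

  ∣-mulP : ∀ {f g} r → f ∣ g → f ∣ mulP r g
  ∣-mulP {f} r (k , kf≈g) = mulP r k , ≈-trans (mulP-assoc r k f) (mulP-congʳ r kf≈g)

  ∣-addP : ∀ {f g g′} → f ∣ g → f ∣ g′ → f ∣ addP g g′
  ∣-addP {f} (k , kf≈g) (k′ , k′f≈g′) = addP k k′ , ≈-trans (mulP-distribʳ k k′ f) (addP-cong kf≈g k′f≈g′)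

  ∣-subP : ∀ {f g g′} → f ∣ g → f ∣ g′ → f ∣ subP g g′
  ∣-subP {f} f∣g (k′ , k′f≈g′) = ∣-addP f∣g (negP k′ , ≈-trans (≈-sym (Polₚ.-‿distribˡ-* k′ f)) (negP-cong k′f≈g′))

  ∣-zero : ∀ f → f ∣ []
  ∣-zero f = [] , ≈-refl

  sub-add : ∀ p r → addP (subP p r) r ≈ p
  sub-add p r = ≈-trans (addP-assoc p (negP r) r) (≈-trans (addP-congʳ p (addP-inverseˡ r)) (addP-identityʳ p))

  record DegreeBelow (p : Pol) (k : ℕ) : Set where
    constructor degreeBelow
    field vanishes : ∀ i → k ≤ i → coeff p i ≡ 0#
  open DegreeBelow

  coeff-beyond-length : ∀ p i → length p ≤ i → coeff p i ≡ 0#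
  coeff-beyond-length []      i       _         = refl
  coeff-beyond-length (a ∷ p) (suc i) (s≤s p≤i) = coeff-beyond-length p i p≤i

  degreeBelow-length : ∀ p → DegreeBelow p (length p)
  degreeBelow-length p = degreeBelow (coeff-beyond-length p)

  degreeBelow-mono : ∀ {p k k′} → k ≤ k′ → DegreeBelow p k → DegreeBelow p k′
  degreeBelow-mono k≤k′ p<k = degreeBelow (λ i k′≤i → vanishes p<k i (ℕₚ.≤-trans k≤k′ k′≤i))

  zero⊎leadingCoefficient : ∀ k p → DegreeBelow p k →
    p ≈ [] ⊎ Σ ℕ λ D → D < k × coeff p D ≢ 0# × DegreeBelow p (suc D)
  zero⊎leadingCoefficient zero    p p<0 = inj₁ (coeffwise (λ i → vanishes p<0 i z≤n))
  zero⊎leadingCoefficient (suc k) p p<k+1 with coeff p k ≟ 0#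
  ... | no pₖ≢0 = inj₂ (k , ℕₚ.≤-refl , pₖ≢0 , p<k+1)
  ... | yes pₖ≡0 with zero⊎leadingCoefficient k p (degreeBelow p<k)
    where
    p<k : ∀ i → k ≤ i → coeff p i ≡ 0#
    p<k i k≤i with ℕₚ.m≤n⇒m<n∨m≡n k≤i
    ... | inj₁ k<i    = vanishes p<k+1 i k<i
    ... | inj₂ refl   = pₖ≡0
  ...   | inj₁ p≈0                    = inj₁ p≈0
  ...   | inj₂ (D , D<k , p_D≢0 , p<D+1) = inj₂ (D , ℕₚ.m≤n⇒m≤1+n D<k , p_D≢0 , p<D+1)

  shift : ℕ → Pol → Pol
  shift zero    p = p
  shift (suc e) p = 0# ∷ shift e p

  coeff-shift : ∀ e p j → coeff (shift e p) (e ℕ.+ j) ≡ coeff p j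
  coeff-shift zero    p j = refl
  coeff-shift (suc e) p j = coeff-shift e p j

  degreeBelow-shift : ∀ e {p b} → DegreeBelow p b → DegreeBelow (shift e p) (e ℕ.+ b)
  degreeBelow-shift zero    p<b = p<b
  degreeBelow-shift (suc e) p<b = degreeBelow λ { (suc i) (s≤s e+b≤i) → vanishes (degreeBelow-shift e p<b) i e+b≤i }

  monomial-mulP : ∀ e p → mulP (monomial e) p ≈ shift e p
  monomial-mulP zero    p = mulP-identityˡ p
  monomial-mulP (suc e) p = ≈-trans (mulP-0∷ (monomial e) p) (∷-cong refl (monomial-mulP e p))

  module Division (g : Pol) (D : ℕ) (g_D≢0 : coeff g D ≢ 0#) (g<D+1 : DegreeBelow g (suc D)) where
    g_D⁻¹ : Carrier
    g_D⁻¹ = proj₁ (inverse (coeff g D) g_D≢0)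

    nextQuotientTerm : ℕ → Pol → Pol
    nextQuotientTerm k f = scaleP (coeff f k * g_D⁻¹) (monomial (k ∸ D))

    cancel-leading : ∀ {k} f → D ≤ k → DegreeBelow f (suc k) → DegreeBelow (subP f (mulP (nextQuotientTerm k f) g)) k
    cancel-leading {k} f D≤k f<k+1 = degreeBelow vanish
      where
      c = coeff f k * g_D⁻¹
      e = k ∸ D
      e+D≡k : e ℕ.+ D ≡ k
      e+D≡k = ℕₚ.m∸n+n≡m D≤k
      term≈ : mulP (nextQuotientTerm k f) g ≈ scaleP c (shift e g)
      term≈ = ≈-trans (mulP-scaleP c (monomial e) g) (scaleP-cong refl (monomial-mulP e g))
      xᵉg<k+1 : DegreeBelow (shift e g) (suc k)
      xᵉg<k+1 = subst (DegreeBelow (shift e g)) (trans (ℕₚ.+-suc e D) (cong suc e+D≡k)) (degreeBelow-shift e g<D+1)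
      [xᵉg]ₖ≡g_D : coeff (shift e g) k ≡ coeff g D
      [xᵉg]ₖ≡g_D = trans (cong (coeff (shift e g)) (sym e+D≡k)) (coeff-shift e g D)
      c*g_D≡fₖ : c * coeff g D ≡ coeff f k
      c*g_D≡fₖ = trans (*-assoc _ _ _) (trans (cong (coeff f k *_) (trans (*-comm _ _) (proj₂ (inverse (coeff g D) g_D≢0))))
                   (*-identityʳ _))
      coeff-step : ∀ i → coeff (subP f (mulP (nextQuotientTerm k f) g)) i ≡ coeff f i + - (c * coeff (shift e g) i)
      coeff-step i = trans (coeff-subP f _ i) (cong (λ v → coeff f i + - v) (trans (at term≈ i) (coeff-scaleP c (shift e g) i)))
      vanish : ∀ i → k ≤ i → coeff (subP f (mulP (nextQuotientTerm k f) g)) i ≡ 0#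
      vanish i k≤i with ℕₚ.m≤n⇒m<n∨m≡n k≤i
      ... | inj₁ k<i = trans (coeff-step i) (begin
        coeff f i + - (c * coeff (shift e g) i)  ≡⟨ cong₂ (λ u v → u + - (c * v)) (vanishes f<k+1 i k<i) (vanishes xᵉg<k+1 i k<i) ⟩
        0# + - (c * 0#)                          ≡⟨ cong (λ v → 0# + - v) (zeroʳ c) ⟩
        0# + - 0#                                ≡⟨ -‿inverseʳ 0# ⟩
        0#                                       ∎)
        where open ≡-Reasoning
      ... | inj₂ refl = trans (coeff-step k) (trans (cong (λ v → coeff f k + - v) (trans (cong (c *_) [xᵉg]ₖ≡g_D) c*g_D≡fₖ))
                          (-‿inverseʳ (coeff f k)))

    record DivMod (f : Pol) : Set where
      field
        quotient remainder : Pol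
        f≈qg+r             : f ≈ addP (mulP quotient g) remainder
        remainder<D        : DegreeBelow remainder D

    divMod : ∀ k f → DegreeBelow f k → DivMod f
    divMod k f f<k with k ℕ.≤? D
    ... | yes k≤D = record { quotient = [] ; remainder = f ; f≈qg+r = ≈-refl ; remainder<D = degreeBelow-mono k≤D f<k }
    divMod zero    f f<k | no k≰D = ⊥-elim (k≰D z≤n)
    divMod (suc k) f f<k | no k≰D = record
      { quotient = addP quotient T ; remainder = remainder ; f≈qg+r = f≈ ; remainder<D = remainder<D }
      where
      T = nextQuotientTerm k f
      open DivMod (divMod k (subP f (mulP T g)) (cancel-leading f (ℕₚ.≤-pred (ℕₚ.≰⇒> k≰D)) f<k))
      f≈ : f ≈ addP (mulP (addP quotient T) g) remainder
      f≈ = ≈-trans (≈-sym (sub-add f (mulP T g))) (≈-trans (addP-cong f≈qg+r ≈-refl)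
        (solveᴾ 4 (λ Q T g R → (Q ⊗ g ⊕ R) ⊕ T ⊗ g ⊜ (Q ⊕ T) ⊗ g ⊕ R) ≈-refl quotient T g remainder))

  record Bezout (f g : Pol) : Set where
    field
      d s t u v : Pol
      d≈sf+tg : d ≈ addP (mulP s f) (mulP t g)
      ud≈f    : mulP u d ≈ f
      vd≈g    : mulP v d ≈ g

  bezout : ∀ k f g → DegreeBelow g k → Bezout f g
  bezout k f g g<k with zero⊎leadingCoefficient k g g<k
  ... | inj₁ g≈0 = record
    { d = f ; s = oneP ; t = [] ; u = oneP ; v = []
    ; d≈sf+tg = ≈-sym (≈-trans (addP-identityʳ _) (mulP-identityˡ f))
    ; ud≈f = mulP-identityˡ f ; vd≈g = ≈-sym g≈0 }
  bezout zero    f g g<k | inj₂ (D , () , _)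
  bezout (suc k) f g g<k | inj₂ (D , s≤s D≤k , g_D≢0 , g<D+1) = record
    { d = B.d ; s = B.t ; t = subP B.s (mulP B.t Q) ; u = addP (mulP Q B.u) B.v ; v = B.u
    ; d≈sf+tg = d≈ ; ud≈f = ud≈f ; vd≈g = B.ud≈f }
    where
    open Division g D g_D≢0 g<D+1
    open DivMod (divMod (length f) f (degreeBelow-length f))
      renaming (quotient to Q; remainder to R; f≈qg+r to f≈Qg+R; remainder<D to R<D)
    module B = Bezout (bezout k g R (degreeBelow-mono D≤k R<D))
    ud≈f : mulP (addP (mulP Q B.u) B.v) B.d ≈ f
    ud≈f = ≈-trans (mulP-distribʳ (mulP Q B.u) B.v B.d)
      (≈-trans (addP-cong (≈-trans (mulP-assoc Q B.u B.d) (mulP-congʳ Q B.ud≈f)) B.vd≈g) (≈-sym f≈Qg+R))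
    d≈ : B.d ≈ addP (mulP B.t f) (mulP (subP B.s (mulP B.t Q)) g)
    d≈ = ≈-sym (begin
      addP (mulP B.t f) (mulP (subP B.s (mulP B.t Q)) g)
        ≈⟨ addP-cong (mulP-congʳ B.t f≈Qg+R) (Polₚ.[y-z]x≈yx-zx g B.s (mulP B.t Q)) ⟩
      addP (mulP B.t (addP (mulP Q g) R)) (addP (mulP B.s g) N)
        ≈⟨ solveᴾ 6 (λ t Q g R s N → t ⊗ (Q ⊗ g ⊕ R) ⊕ (s ⊗ g ⊕ N) ⊜ (t ⊗ Q ⊗ g ⊕ N) ⊕ (s ⊗ g ⊕ t ⊗ R)) ≈-refl B.t Q g R B.s N ⟩
      addP (addP (mulP (mulP B.t Q) g) N) (addP (mulP B.s g) (mulP B.t R))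
        ≈⟨ addP-cong (addP-inverseʳ (mulP (mulP B.t Q) g)) ≈-refl ⟩
      addP (mulP B.s g) (mulP B.t R)
        ≈⟨ B.d≈sf+tg ⟨
      B.d ∎)
      where
      open ≈-Reasoning
      N = negP (mulP (mulP B.t Q) g)

  irreducible-nonUnit : ∀ {h} → Irreducible h → ¬ h ∣ oneP
  irreducible-nonUnit (_ , h-nonUnit , _) (u , uh≈1) = h-nonUnit (u , at uh≈1)

  -- With d = s h + t a a common divisor of h = u d and a = v d: if u is a unit then h ∣ d ∣ a,
  -- and if d is a unit then b = d⁻¹ (s b h + t a b) is a multiple of h.
  irreducible⇒prime : ∀ {h} → Irreducible h → ∀ a b → h ∣ mulP a b → h ∣ a ⊎ h ∣ b
  irreducible⇒prime {h} (_ , _ , split) a b h∣ab = unit-case (split B.u B.d (at B.ud≈f))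
    where
    open ≈-Reasoning
    module B = Bezout (bezout (length a) h a (degreeBelow-length a))
    unit-case : IsUnit B.u ⊎ IsUnit B.d → h ∣ a ⊎ h ∣ b
    unit-case (inj₁ (w , wu≈1)) = inj₁ (mulP B.v w , (begin
      mulP (mulP B.v w) h               ≈⟨ mulP-congʳ (mulP B.v w) B.ud≈f ⟨
      mulP (mulP B.v w) (mulP B.u B.d)  ≈⟨ solveᴾ 4 (λ v w u d → (v ⊗ w) ⊗ (u ⊗ d) ⊜ v ⊗ d ⊗ (w ⊗ u)) ≈-refl B.v w B.u B.d ⟩
      mulP (mulP B.v B.d) (mulP w B.u)  ≈⟨ mulP-congʳ (mulP B.v B.d) (coeffwise {mulP w B.u} wu≈1) ⟩
      mulP (mulP B.v B.d) oneP          ≈⟨ mulP-identityʳ (mulP B.v B.d) ⟩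
      mulP B.v B.d                      ≈⟨ B.vd≈g ⟩
      a                                 ∎))
    unit-case (inj₂ (w , wd≈1)) = inj₂ (∣-respʳ wdb≈b (∣-mulP w (∣-respʳ (≈-sym db≈) h∣sbh+tab)))
      where
      h∣sbh+tab : h ∣ addP (mulP (mulP B.s b) h) (mulP B.t (mulP a b))
      h∣sbh+tab = ∣-addP (∣-mulP (mulP B.s b) (∣-refl h)) (∣-mulP B.t h∣ab)
      db≈ : mulP B.d b ≈ addP (mulP (mulP B.s b) h) (mulP B.t (mulP a b))
      db≈ = begin
        mulP B.d b                                         ≈⟨ mulP-congˡ b B.d≈sf+tg ⟩
        mulP (addP (mulP B.s h) (mulP B.t a)) b
          ≈⟨ solveᴾ 5 (λ s h t a b → (s ⊗ h ⊕ t ⊗ a) ⊗ b ⊜ (s ⊗ b) ⊗ h ⊕ t ⊗ (a ⊗ b)) ≈-refl B.s h B.t a b ⟩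
        addP (mulP (mulP B.s b) h) (mulP B.t (mulP a b))   ∎
      wdb≈b : mulP w (mulP B.d b) ≈ b
      wdb≈b = ≈-trans (≈-sym (mulP-assoc w B.d b)) (≈-trans (mulP-congˡ b (coeffwise {mulP w B.d} wd≈1)) (mulP-identityˡ b))

  X : Pol
  X = monomial 1

  linear : Carrier → Pol
  linear a = subP X [ a ]

  module Evaluation (R : CommutativeRing 0ℓ 0ℓ) (ι : Carrier → CommutativeRing.Carrier R)
    (ι-isRingHomomorphism : IsRingHomomorphism (CommutativeRing.rawRing field-commutativeRing) (CommutativeRing.rawRing R) ι)
    where
    open IsRingHomomorphism ι-isRingHomomorphism using (+-homo; *-homo; -‿homo; 0#-homo; 1#-homo)
    open CommutativeRing R using (setoid; semiring; commutativeSemiring; ring; +-cong; +-congˡ; *-congˡ)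
      renaming (Carrier to Rᶜ; _≈_ to _≈ᴿ_; _+_ to _+ᴿ_; _*_ to _*ᴿ_; -_ to -ᴿ_; 0# to 0ᴿ; 1# to 1ᴿ;
                refl to Rrefl; sym to Rsym; trans to Rtrans; reflexive to Rreflexive;
                +-identityˡ to +ᴿ-identityˡ; +-identityʳ to +ᴿ-identityʳ; zeroˡ to zeroᴿˡ; zeroʳ to zeroᴿʳ;
                *-identityʳ to *ᴿ-identityʳ; -‿cong to -ᴿ-cong)
    open import Algebra.Properties.Semiring.Exp semiring public using () renaming (_^_ to _^ᴿ_)
    private
      module Rₚ = RingProperties ring
      open SemiringSolver commutativeSemiring using () renaming (solve to solveᴿ; _:+_ to _+ₑ_; _:*_ to _*ₑ_; _:=_ to _=ₑ_)
      open Relation.Binary.Reasoning.Setoid setoid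

    eval : Pol → Rᶜ → Rᶜ
    eval []      z = 0ᴿ
    eval (a ∷ p) z = ι a +ᴿ z *ᴿ eval p z

    eval-addP : ∀ p r z → eval (addP p r) z ≈ᴿ eval p z +ᴿ eval r z
    eval-addP []      r       z = Rsym (+ᴿ-identityˡ _)
    eval-addP (a ∷ p) []      z = Rsym (+ᴿ-identityʳ _)
    eval-addP (a ∷ p) (b ∷ r) z = begin
      ι (a + b) +ᴿ z *ᴿ eval (addP p r) z          ≈⟨ +-cong (+-homo a b) (*-congˡ (eval-addP p r z)) ⟩
      (ι a +ᴿ ι b) +ᴿ z *ᴿ (eval p z +ᴿ eval r z)
        ≈⟨ solveᴿ 5 (λ x y z u v → (x +ₑ y) +ₑ z *ₑ (u +ₑ v) =ₑ (x +ₑ z *ₑ u) +ₑ (y +ₑ z *ₑ v)) Rrefl (ι a) (ι b) z (eval p z) (eval r z) ⟩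
      (ι a +ᴿ z *ᴿ eval p z) +ᴿ (ι b +ᴿ z *ᴿ eval r z) ∎

    eval-negP : ∀ p z → eval (negP p) z ≈ᴿ -ᴿ eval p z
    eval-negP []      z = Rsym Rₚ.-0#≈0#
    eval-negP (a ∷ p) z = begin
      ι (- a) +ᴿ z *ᴿ eval (negP p) z    ≈⟨ +-cong (-‿homo a) (*-congˡ (eval-negP p z)) ⟩
      -ᴿ ι a +ᴿ z *ᴿ -ᴿ eval p z         ≈⟨ +-congˡ (Rₚ.-‿distribʳ-* z (eval p z)) ⟨
      -ᴿ ι a +ᴿ -ᴿ (z *ᴿ eval p z)       ≈⟨ Rₚ.-‿+-comm (ι a) (z *ᴿ eval p z) ⟩
      -ᴿ (ι a +ᴿ z *ᴿ eval p z)          ∎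

    eval-subP : ∀ p r z → eval (subP p r) z ≈ᴿ eval p z +ᴿ -ᴿ eval r z
    eval-subP p r z = Rtrans (eval-addP p (negP r) z) (+-congˡ (eval-negP r z))

    eval-scaleP : ∀ c p z → eval (scaleP c p) z ≈ᴿ ι c *ᴿ eval p z
    eval-scaleP c []      z = Rsym (zeroᴿʳ _)
    eval-scaleP c (a ∷ p) z = begin
      ι (c * a) +ᴿ z *ᴿ eval (scaleP c p) z  ≈⟨ +-cong (*-homo c a) (*-congˡ (eval-scaleP c p z)) ⟩
      ι c *ᴿ ι a +ᴿ z *ᴿ (ι c *ᴿ eval p z)   ≈⟨ solveᴿ 4 (λ c a z e → c *ₑ a +ₑ z *ₑ (c *ₑ e) =ₑ c *ₑ (a +ₑ z *ₑ e)) Rrefl (ι c) (ι a) z (eval p z) ⟩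
      ι c *ᴿ (ι a +ᴿ z *ᴿ eval p z)          ∎

    eval-zero : ∀ {p} z → p ≈ [] → eval p z ≈ᴿ 0ᴿ
    eval-zero {[]}    z p≈0 = Rrefl
    eval-zero {a ∷ p} z p≈0 = begin
      ι a +ᴿ z *ᴿ eval p z  ≈⟨ +-cong (Rtrans (Rreflexive (cong ι (at p≈0 zero))) 0#-homo) (*-congˡ (eval-zero {p} z (coeffwise (at p≈0 ∘ suc)))) ⟩
      0ᴿ +ᴿ z *ᴿ 0ᴿ         ≈⟨ +ᴿ-identityˡ _ ⟩
      z *ᴿ 0ᴿ               ≈⟨ zeroᴿʳ z ⟩
      0ᴿ                    ∎

    eval-cong : ∀ {p r} z → p ≈ r → eval p z ≈ᴿ eval r z
    eval-cong {p} {r} z p≈r = Rₚ.x∙y⁻¹≈ε⇒x≈y (eval p z) (eval r z)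
      (Rtrans (Rsym (eval-subP p r z)) (eval-zero z (≈-trans (subP-cong p≈r ≈-refl) (addP-inverseʳ r))))

    eval-mulP : ∀ p r z → eval (mulP p r) z ≈ᴿ eval p z *ᴿ eval r z
    eval-mulP []      r z = Rsym (zeroᴿˡ _)
    eval-mulP (a ∷ p) r z = begin
      eval (addP (scaleP a r) (0# ∷ mulP p r)) z                ≈⟨ eval-addP (scaleP a r) (0# ∷ mulP p r) z ⟩
      eval (scaleP a r) z +ᴿ (ι 0# +ᴿ z *ᴿ eval (mulP p r) z)   ≈⟨ +-cong (eval-scaleP a r z) (+-cong 0#-homo (*-congˡ (eval-mulP p r z))) ⟩
      ι a *ᴿ eval r z +ᴿ (0ᴿ +ᴿ z *ᴿ (eval p z *ᴿ eval r z))    ≈⟨ +-congˡ (+ᴿ-identityˡ _) ⟩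
      ι a *ᴿ eval r z +ᴿ z *ᴿ (eval p z *ᴿ eval r z)
        ≈⟨ solveᴿ 4 (λ a r z p → a *ₑ r +ₑ z *ₑ (p *ₑ r) =ₑ (a +ₑ z *ₑ p) *ₑ r) Rrefl (ι a) (eval r z) z (eval p z) ⟩
      (ι a +ᴿ z *ᴿ eval p z) *ᴿ eval r z                        ∎

    eval-constant : ∀ a z → eval (a ∷ []) z ≈ᴿ ι a
    eval-constant a z = Rtrans (+-congˡ (zeroᴿʳ z)) (+ᴿ-identityʳ _)

    eval-monomial : ∀ k z → eval (monomial k) z ≈ᴿ z ^ᴿ k
    eval-monomial zero    z = Rtrans (eval-constant 1# z) 1#-homo
    eval-monomial (suc k) z = Rtrans (+-cong 0#-homo (*-congˡ (eval-monomial k z))) (+ᴿ-identityˡ _)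

    eval-X : ∀ z → eval X z ≈ᴿ z
    eval-X z = Rtrans (eval-monomial 1 z) (*ᴿ-identityʳ z)

    eval-linear : ∀ a z → eval (linear a) z ≈ᴿ z +ᴿ -ᴿ ι a
    eval-linear a z = Rtrans (eval-subP X [ a ] z) (+-cong (eval-X z) (-ᴿ-cong (eval-constant a z)))

  [*] : ∀ a b → [ a * b ] ≈ mulP [ a ] [ b ]
  [*] a b = ∷-cong (sym (+-identityʳ _)) ≈-refl

  constant-isRingHomomorphism :
    IsRingHomomorphism (CommutativeRing.rawRing field-commutativeRing) (CommutativeRing.rawRing polynomial-commutativeRing) [_]
  constant-isRingHomomorphism = record
    { isSemiringHomomorphism = record
      { isNearSemiringHomomorphism = record
        { +-isMonoidHomomorphism = record
          { isMagmaHomomorphism = record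
            { isRelHomomorphism = record { cong = λ a≡b → ∷-cong a≡b ≈-refl }
            ; homo = λ _ _ → ≈-refl }
          ; ε-homo = ∷-zero ≈-refl }
        ; *-homo = [*] }
      ; 1#-homo = ≈-refl }
    ; -‿homo = λ _ → ≈-refl }

  module AtPoint = Evaluation field-commutativeRing id (Identity.isRingHomomorphism (CommutativeRing.rawRing field-commutativeRing) refl)
  module AtPolynomial = Evaluation polynomial-commutativeRing [_] constant-isRingHomomorphism

  X*p≈0∷p : ∀ p → mulP X p ≈ (0# ∷ p)
  X*p≈0∷p p = ≈-trans (mulP-0∷ oneP p) (∷-cong refl (mulP-identityˡ p))

  ∷≈[_]+X* : ∀ b p → (b ∷ p) ≈ addP [ b ] (mulP X p)
  ∷≈[ b ]+X* p = ≈-sym (≈-trans (addP-congʳ [ b ] (X*p≈0∷p p)) (∷-cong (+-identityʳ b) ≈-refl))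

  -- Synthetic division: the quotient's coefficients are the Horner partial values of f at a.
  divideByLinear : Pol → Carrier → Pol
  divideByLinear []          a = []
  divideByLinear (b ∷ [])    a = []
  divideByLinear (b ∷ c ∷ f) a = AtPoint.eval (c ∷ f) a ∷ divideByLinear (c ∷ f) a

  length-divideByLinear : ∀ f a → length (divideByLinear f a) ≡ length f ∸ 1
  length-divideByLinear []          a = refl
  length-divideByLinear (b ∷ [])    a = refl
  length-divideByLinear (b ∷ c ∷ f) a = cong suc (length-divideByLinear (c ∷ f) a)

  divideByLinear-remainder : ∀ f a → f ≈ addP (mulP (linear a) (divideByLinear f a)) [ AtPoint.eval f a ]
  divideByLinear-remainder []          a = ≈-sym (≈-trans (addP-cong (mulP-zeroʳ (linear a)) ≈-refl) (∷-zero ≈-refl))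
  divideByLinear-remainder (b ∷ [])    a =
    ≈-sym (≈-trans (addP-cong (mulP-zeroʳ (linear a)) ≈-refl) (∷-cong (AtPoint.eval-constant b a) ≈-refl))
  divideByLinear-remainder (b ∷ c ∷ f) a = begin
    b ∷ f′                                                ≈⟨ ∷≈[ b ]+X* f′ ⟩
    addP [ b ] (mulP X f′)                                ≈⟨ addP-congʳ [ b ] (mulP-congʳ X (divideByLinear-remainder (c ∷ f) a)) ⟩
    addP [ b ] (mulP X (addP (mulP (addP X N) g) [ v ]))  ≈⟨ addP-identityʳ _ ⟨
    addP (addP [ b ] (mulP X (addP (mulP (addP X N) g) [ v ]))) []
      ≈⟨ addP-congʳ (addP [ b ] (mulP X (addP (mulP (addP X N) g) [ v ]))) (mulP-congˡ [ v ] (addP-inverseˡ [ a ])) ⟨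
    addP (addP [ b ] (mulP X (addP (mulP (addP X N) g) [ v ]))) (mulP (addP N [ a ]) [ v ])
      ≈⟨ solveᴾ 6 (λ X N g v b a → (b ⊕ X ⊗ ((X ⊕ N) ⊗ g ⊕ v)) ⊕ (N ⊕ a) ⊗ v ⊜ (X ⊕ N) ⊗ (v ⊕ X ⊗ g) ⊕ (b ⊕ a ⊗ v))
           ≈-refl X N g [ v ] [ b ] [ a ] ⟩
    addP (mulP (addP X N) (addP [ v ] (mulP X g))) (addP [ b ] (mulP [ a ] [ v ]))
      ≈⟨ addP-cong (mulP-congʳ (linear a) (∷≈[ v ]+X* g)) (addP-congʳ [ b ] ([*] a v)) ⟨
    addP (mulP (linear a) (v ∷ g)) [ b + a * v ]          ∎
    where
    open ≈-Reasoning
    f′ = c ∷ f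
    v = AtPoint.eval f′ a
    g = divideByLinear f′ a
    N = negP [ a ]

  linearFactors : List Carrier → Pol
  linearFactors []      = oneP
  linearFactors (a ∷ S) = mulP (linear a) (linearFactors S)

  eval-linearFactors-nonZero : ∀ a S → All (a ≢_) S → AtPoint.eval (linearFactors S) a ≢ 0#
  eval-linearFactors-nonZero a []      []           = λ 1[a]≡0 → 0≢1 (trans (sym 1[a]≡0) (AtPoint.eval-constant 1# a))
  eval-linearFactors-nonZero a (b ∷ S) (a≢b ∷ a∉S) =
    x≢0∧y≢0⇒x*y≢0 a-b≢0 (eval-linearFactors-nonZero a S a∉S) ∘ trans (sym (AtPoint.eval-mulP (linear b) (linearFactors S) a))
    where
    a-b≢0 : AtPoint.eval (linear b) a ≢ 0#
    a-b≢0 a-b≡0 = a≢b (Fₚ.x∙y⁻¹≈ε⇒x≈y a b (trans (sym (AtPoint.eval-linear b a)) a-b≡0))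

  divide-roots : ∀ S f → Unique S → All (λ a → AtPoint.eval f a ≡ 0#) S →
    Σ Pol λ g → f ≈ mulP (linearFactors S) g × length g ≡ length f ∸ length S
  divide-roots []      f _             _            = f , ≈-sym (mulP-identityˡ f) , refl
  divide-roots (a ∷ S) f (a∉S ∷ S-unique) (f[a]≡0 ∷ f[S]≡0) with divide-roots S f S-unique f[S]≡0
  ... | g , f≈Sg , |g| = divideByLinear g a , f≈ , |g/[x-a]|
    where
    g[a]≡0 : AtPoint.eval g a ≡ 0#
    g[a]≡0 with x*y≡0⇒x≡0⊎y≡0 _ _ (trans (sym (AtPoint.eval-mulP (linearFactors S) g a)) (trans (sym (AtPoint.eval-cong a f≈Sg)) f[a]≡0))
    ... | inj₁ S[a]≡0 = ⊥-elim (eval-linearFactors-nonZero a S a∉S S[a]≡0)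
    ... | inj₂ g[a]≡0 = g[a]≡0
    g≈ : g ≈ mulP (linear a) (divideByLinear g a)
    g≈ = ≈-trans (divideByLinear-remainder g a)
      (≈-trans (addP-congʳ (mulP (linear a) (divideByLinear g a)) (≈-trans (∷-cong g[a]≡0 ≈-refl) (∷-zero ≈-refl))) (addP-identityʳ _))
    f≈ : f ≈ mulP (mulP (linear a) (linearFactors S)) (divideByLinear g a)
    f≈ = ≈-trans f≈Sg (≈-trans (mulP-congʳ (linearFactors S) g≈)
      (solveᴾ 3 (λ P L G → P ⊗ (L ⊗ G) ⊜ (L ⊗ P) ⊗ G) ≈-refl (linearFactors S) (linear a) (divideByLinear g a)))
    |g/[x-a]| : length (divideByLinear g a) ≡ length f ∸ suc (length S)
    |g/[x-a]| = trans (length-divideByLinear g a) (trans (cong (_∸ 1) |g|)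
      (trans (ℕₚ.∸-+-assoc (length f) (length S) 1) (cong (length f ∸_) (ℕₚ.+-comm (length S) 1))))

  length-monomial : ∀ k → length (monomial k) ≡ suc k
  length-monomial zero    = refl
  length-monomial (suc k) = cong suc (length-monomial k)

  coeff-monomial : ∀ k → coeff (monomial k) k ≡ 1#
  coeff-monomial zero    = refl
  coeff-monomial (suc k) = coeff-monomial k

  length-xᵏ-x : ∀ k → 2 ≤ k → length (subP (monomial k) X) ≡ suc k
  length-xᵏ-x (suc zero)    (s≤s ())
  length-xᵏ-x (suc (suc k)) _ = cong (λ n → suc (suc n)) (trans (length-addP-[] (monomial k)) (length-monomial k))
    where
    length-addP-[] : ∀ p → length (addP p []) ≡ length p
    length-addP-[] []      = refl
    length-addP-[] (_ ∷ _) = refl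

  coeff-xᵏ-x : ∀ k → 2 ≤ k → coeff (subP (monomial k) X) k ≡ 1#
  coeff-xᵏ-x (suc zero)    (s≤s ())
  coeff-xᵏ-x (suc (suc k)) _ = begin
    coeff (subP (monomial (2 ℕ.+ k)) X) (2 ℕ.+ k)   ≡⟨ coeff-subP (monomial (2 ℕ.+ k)) X (2 ℕ.+ k) ⟩
    coeff (monomial k) k + - 0#                     ≡⟨ cong₂ (λ u v → u + - v) (coeff-monomial k) refl ⟩
    1# + - 0#                                       ≡⟨ cong (1# +_) Fₚ.-0#≈0# ⟩
    1# + 0#                                         ≡⟨ +-identityʳ 1# ⟩
    1#                                              ∎
    where open ≡-Reasoning

  allElements : List Carrier
  allElements = tabulate enum

  allElements-unique : Unique allElements
  allElements-unique = Uniqueₚ.tabulate⁺ (λ {i} {j} eq → trans (sym (index-enum i)) (trans (cong index eq) (index-enum j)))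

  xᵠ-x : Pol
  xᵠ-x = subP (monomial q) X

  eval-xᵠ-x : ∀ a → AtPoint.eval xᵠ-x a ≡ 0#
  eval-xᵠ-x a = trans (AtPoint.eval-subP (monomial q) X a)
    (trans (cong₂ (λ u v → u + - v) (trans (AtPoint.eval-monomial q a) (fermat a)) (AtPoint.eval-X a))
      (-‿inverseʳ a))

  xᵠ-x≈c∏[x-a] : Σ Carrier λ c → c ≢ 0# × xᵠ-x ≈ mulP (linearFactors allElements) [ c ]
  xᵠ-x≈c∏[x-a] with divide-roots allElements xᵠ-x allElements-unique (All.universal eval-xᵠ-x allElements)
  ... | g , xᵠ-x≈∏g , |g| = constant g xᵠ-x≈∏g
    (trans |g| (trans (cong₂ _∸_ (length-xᵏ-x q 2≤q) (length-tabulate enum)) (ℕₚ.m+n∸n≡m 1 q)))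
    where
    constant : ∀ g → xᵠ-x ≈ mulP (linearFactors allElements) g → length g ≡ 1 →
      Σ Carrier λ c → c ≢ 0# × xᵠ-x ≈ mulP (linearFactors allElements) [ c ]
    constant (c ∷ []) xᵠ-x≈∏c _ = c , c≢0 , xᵠ-x≈∏c
      where
      c≢0 : c ≢ 0#
      c≢0 refl = 0≢1 (trans (sym (at xᵠ-x≈0 q)) (coeff-xᵏ-x q 2≤q))
        where
        xᵠ-x≈0 : xᵠ-x ≈ []
        xᵠ-x≈0 = ≈-trans xᵠ-x≈∏c (≈-trans (mulP-congʳ (linearFactors allElements) (∷-zero ≈-refl)) (mulP-zeroʳ (linearFactors allElements)))

  open AtPolynomial using () renaming (_^ᴿ_ to _^ᴾ_)

  ∣-nonZeroConstant⇒∣1 : ∀ {h c} → c ≢ 0# → h ∣ [ c ] → h ∣ oneP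
  ∣-nonZeroConstant⇒∣1 {h} {c} c≢0 (k , kh≈c) = mulP [ c⁻¹ ] k , (begin
    mulP (mulP [ c⁻¹ ] k) h  ≈⟨ mulP-assoc [ c⁻¹ ] k h ⟩
    mulP [ c⁻¹ ] (mulP k h)  ≈⟨ mulP-congʳ [ c⁻¹ ] kh≈c ⟩
    mulP [ c⁻¹ ] [ c ]       ≈⟨ [*] c⁻¹ c ⟨
    [ c⁻¹ * c ]              ≈⟨ ∷-cong (trans (*-comm c⁻¹ c) (proj₂ (inverse c c≢0))) ≈-refl ⟩
    oneP                     ∎)
    where
    open ≈-Reasoning
    c⁻¹ = proj₁ (inverse c c≢0)

  irreducible-∣-linearFactors : ∀ {h} → Irreducible h → ∀ y S → h ∣ AtPolynomial.eval (linearFactors S) y →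
    Σ Carrier λ a → h ∣ subP y [ a ]
  irreducible-∣-linearFactors h-irr y [] h∣1 = ⊥-elim (irreducible-nonUnit h-irr (∣-respʳ (AtPolynomial.eval-constant 1# y) h∣1))
  irreducible-∣-linearFactors h-irr y (a ∷ S) h∣∏
    with irreducible⇒prime h-irr _ _ (∣-respʳ (AtPolynomial.eval-mulP (linear a) (linearFactors S) y) h∣∏)
  ... | inj₁ h∣y-a = a , ∣-respʳ (AtPolynomial.eval-linear a y) h∣y-a
  ... | inj₂ h∣∏S = irreducible-∣-linearFactors h-irr y S h∣∏S

  irreducible-∣yᵠ-y : ∀ {h} → Irreducible h → ∀ y → h ∣ subP (y ^ᴾ q) y → Σ Carrier λ a → h ∣ subP y [ a ]
  irreducible-∣yᵠ-y h-irr y h∣yᵠ-y with xᵠ-x≈c∏[x-a]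
  ... | c , c≢0 , xᵠ-x≈c∏ with irreducible⇒prime h-irr _ _ (∣-respʳ yᵠ-y≈ h∣yᵠ-y)
    where
    open AtPolynomial using (eval; eval-monomial; eval-X; eval-subP; eval-cong; eval-mulP; eval-constant)
    ∏[y-a] = eval (linearFactors allElements) y
    yᵠ-y≈ : subP (y ^ᴾ q) y ≈ mulP ∏[y-a] [ c ]
    yᵠ-y≈ = begin
      subP (y ^ᴾ q) y                                      ≈⟨ subP-cong (eval-monomial q y) (eval-X y) ⟨
      subP (eval (monomial q) y) (eval X y)                ≈⟨ eval-subP (monomial q) X y ⟨
      eval xᵠ-x y                                          ≈⟨ eval-cong y xᵠ-x≈c∏ ⟩
      eval (mulP (linearFactors allElements) [ c ]) y      ≈⟨ eval-mulP (linearFactors allElements) [ c ] y ⟩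
      mulP ∏[y-a] (eval [ c ] y)                           ≈⟨ mulP-congʳ ∏[y-a] (eval-constant c y) ⟩
      mulP ∏[y-a] [ c ]                                    ∎
      where open ≈-Reasoning
  ...   | inj₁ h∣∏ = irreducible-∣-linearFactors h-irr y allElements h∣∏
  ...   | inj₂ h∣c = ⊥-elim (irreducible-nonUnit h-irr (∣-nonZeroConstant⇒∣1 c≢0 h∣c))

  open import Algebra.Properties.Semiring.Exp (CommutativeRing.semiring polynomial-commutativeRing) using (^-homo-*; ^-assocʳ)

  monomial≈X^ : ∀ k → monomial k ≈ X ^ᴾ k
  monomial≈X^ zero    = ≈-refl
  monomial≈X^ (suc k) = ≈-trans (∷-cong refl (monomial≈X^ k)) (≈-sym (X*p≈0∷p (X ^ᴾ k)))

  subP-telescope : ∀ a b c → addP (subP a b) (subP b c) ≈ subP a c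
  subP-telescope a b c = begin
    addP (addP a (negP b)) (addP b (negP c))   ≈⟨ solveᴾ 4 (λ a b′ b c′ → (a ⊕ b′) ⊕ (b ⊕ c′) ⊜ (a ⊕ c′) ⊕ (b′ ⊕ b)) ≈-refl a (negP b) b (negP c) ⟩
    addP (subP a c) (addP (negP b) b)         ≈⟨ addP-congʳ (subP a c) (addP-inverseˡ b) ⟩
    addP (subP a c) []                        ≈⟨ addP-identityʳ (subP a c) ⟩
    subP a c                                  ∎
    where open ≈-Reasoning

  Z-1∣Zˢ-1 : ∀ Z s → subP Z oneP ∣ subP (Z ^ᴾ s) oneP
  Z-1∣Zˢ-1 Z zero    = ∣-respʳ (≈-sym (addP-inverseʳ oneP)) (∣-zero _)
  Z-1∣Zˢ-1 Z (suc s) = ∣-respʳ Zˢ⁺¹-1≈ (∣-addP (∣-mulP Z (Z-1∣Zˢ-1 Z s)) (∣-refl (subP Z oneP)))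
    where
    open ≈-Reasoning
    Zˢ⁺¹-1≈ : addP (mulP Z (subP (Z ^ᴾ s) oneP)) (subP Z oneP) ≈ subP (Z ^ᴾ suc s) oneP
    Zˢ⁺¹-1≈ = begin
      addP (mulP Z (subP (Z ^ᴾ s) oneP)) (subP Z oneP)      ≈⟨ addP-cong (Polₚ.x[y-z]≈xy-xz Z (Z ^ᴾ s) oneP) ≈-refl ⟩
      addP (subP (Z ^ᴾ suc s) (mulP Z oneP)) (subP Z oneP)  ≈⟨ addP-cong (subP-cong (≈-refl {Z ^ᴾ suc s}) (mulP-identityʳ Z)) ≈-refl ⟩
      addP (subP (Z ^ᴾ suc s) Z) (subP Z oneP)              ≈⟨ subP-telescope (Z ^ᴾ suc s) Z oneP ⟩
      subP (Z ^ᴾ suc s) oneP                                ∎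

  ∣xⁿ-1⇒∣yᵠ-y : ∀ {h n t s} → h ∣ xᵉ-1 n → t ℕ.* (q ∸ 1) ≡ s ℕ.* n → h ∣ subP ((X ^ᴾ t) ^ᴾ q) (X ^ᴾ t)
  ∣xⁿ-1⇒∣yᵠ-y {h} {n} {t} {s} h∣xⁿ-1 t[q-1]≡sn =
    ∣-respʳ y[xⁿˢ-1]≈yᵠ-y (∣-mulP y (∣-trans (∣-respʳ (subP-cong (monomial≈X^ n) ≈-refl) h∣xⁿ-1) (Z-1∣Zˢ-1 (X ^ᴾ n) s)))
    where
    open ≈-Reasoning
    y = X ^ᴾ t
    q≡1+[q-1] : q ≡ 1 ℕ.+ (q ∸ 1)
    q≡1+[q-1] = sym (ℕₚ.m+[n∸m]≡n (ℕₚ.≤-trans (s≤s z≤n) 2≤q))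
    yᵠ≈ : y ^ᴾ q ≈ mulP y ((X ^ᴾ n) ^ᴾ s)
    yᵠ≈ = begin
      y ^ᴾ q                         ≈⟨ ^-assocʳ X t q ⟩
      X ^ᴾ (t ℕ.* q)                 ≡⟨ cong (λ m → X ^ᴾ (t ℕ.* m)) q≡1+[q-1] ⟩
      X ^ᴾ (t ℕ.* (1 ℕ.+ (q ∸ 1)))   ≡⟨ cong (X ^ᴾ_) (trans (ℕₚ.*-distribˡ-+ t 1 (q ∸ 1)) (cong₂ ℕ._+_ (ℕₚ.*-identityʳ t) t[q-1]≡sn)) ⟩
      X ^ᴾ (t ℕ.+ s ℕ.* n)           ≈⟨ ^-homo-* X t (s ℕ.* n) ⟩
      mulP y (X ^ᴾ (s ℕ.* n))        ≡⟨ cong (λ m → mulP y (X ^ᴾ m)) (ℕₚ.*-comm s n) ⟩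
      mulP y (X ^ᴾ (n ℕ.* s))        ≈⟨ mulP-congʳ y (^-assocʳ X n s) ⟨
      mulP y ((X ^ᴾ n) ^ᴾ s)         ∎
    y[xⁿˢ-1]≈yᵠ-y : mulP y (subP ((X ^ᴾ n) ^ᴾ s) oneP) ≈ subP (y ^ᴾ q) y
    y[xⁿˢ-1]≈yᵠ-y = ≈-trans (Polₚ.x[y-z]≈xy-xz y ((X ^ᴾ n) ^ᴾ s) oneP) (subP-cong (≈-sym yᵠ≈) (mulP-identityʳ y))

  module ℕ+ = CommutativeSemigroupProperties ℕₚ.+-commutativeSemigroup
  module ℕ* = CommutativeSemigroupProperties ℕₚ.*-commutativeSemigroup

  δ₀ : ℕ → Carrier
  δ₀ zero    = 1#
  δ₀ (suc _) = 0#

  -- cyclicCoeff p i is the coefficient of xⁱ in p mod xⁿ - 1, i.e. the sum of the p_k with k ≡ i (mod n);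
  -- the index i + k·n′ ≡ i - k avoids truncated subtraction.
  module Cyclic (n′ : ℕ) where
    n : ℕ
    n = suc n′

    cyclicCoeff : Pol → ℕ → Carrier
    cyclicCoeff []      i = 0#
    cyclicCoeff (b ∷ p) i = δ₀ (i % n) * b + cyclicCoeff p (i ℕ.+ n′)

    cyclicCoeff-addP : ∀ p r i → cyclicCoeff (addP p r) i ≡ cyclicCoeff p i + cyclicCoeff r i
    cyclicCoeff-addP []      r       i = sym (+-identityˡ _)
    cyclicCoeff-addP (a ∷ p) []      i = sym (+-identityʳ _)
    cyclicCoeff-addP (a ∷ p) (b ∷ r) i =
      trans (cong₂ _+_ (distribˡ (δ₀ (i % n)) a b) (cyclicCoeff-addP p r (i ℕ.+ n′)))
        (solve 4 (λ a b c d → (a :+ b) :+ (c :+ d) := (a :+ c) :+ (b :+ d)) refl _ _ _ _)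

    cyclicCoeff-negP : ∀ p i → cyclicCoeff (negP p) i ≡ - cyclicCoeff p i
    cyclicCoeff-negP []      i = sym Fₚ.-0#≈0#
    cyclicCoeff-negP (a ∷ p) i =
      trans (cong₂ _+_ (sym (Fₚ.-‿distribʳ-* (δ₀ (i % n)) a)) (cyclicCoeff-negP p (i ℕ.+ n′))) (Fₚ.-‿+-comm _ _)

    cyclicCoeff-scaleP : ∀ c p i → cyclicCoeff (scaleP c p) i ≡ c * cyclicCoeff p i
    cyclicCoeff-scaleP c []      i = sym (zeroʳ c)
    cyclicCoeff-scaleP c (a ∷ p) i =
      trans (cong₂ _+_ (solve 3 (λ d c a → d :* (c :* a) := c :* (d :* a)) refl (δ₀ (i % n)) c a) (cyclicCoeff-scaleP c p (i ℕ.+ n′)))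
        (sym (distribˡ c _ _))

    cyclicCoeff-0∷ : ∀ p i → cyclicCoeff (0# ∷ p) i ≡ cyclicCoeff p (i ℕ.+ n′)
    cyclicCoeff-0∷ p i = trans (cong (_+ cyclicCoeff p (i ℕ.+ n′)) (zeroʳ _)) (+-identityˡ _)

    cyclicCoeff-zero : ∀ {p} i → p ≈ [] → cyclicCoeff p i ≡ 0#
    cyclicCoeff-zero {[]}    i p≈0 = refl
    cyclicCoeff-zero {a ∷ p} i p≈0 = trans (cong₂ _+_ (trans (cong (δ₀ (i % n) *_) (at p≈0 0)) (zeroʳ _))
      (cyclicCoeff-zero {p} (i ℕ.+ n′) (coeffwise (at p≈0 ∘ suc)))) (+-identityʳ 0#)

    cyclicCoeff-cong : ∀ {p r} i → p ≈ r → cyclicCoeff p i ≡ cyclicCoeff r i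
    cyclicCoeff-cong {p} {r} i p≈r = Fₚ.x∙y⁻¹≈ε⇒x≈y _ _ (begin
      cyclicCoeff p i + - cyclicCoeff r i   ≡⟨ cong (cyclicCoeff p i +_) (cyclicCoeff-negP r i) ⟨
      cyclicCoeff p i + cyclicCoeff (negP r) i ≡⟨ cyclicCoeff-addP p (negP r) i ⟨
      cyclicCoeff (subP p r) i               ≡⟨ cyclicCoeff-zero i (≈-trans (subP-cong p≈r ≈-refl) (addP-inverseʳ r)) ⟩
      0#                                     ∎)
      where open ≡-Reasoning

    cyclicCoeff-periodic : ∀ p i k → cyclicCoeff p (i ℕ.+ k ℕ.* n) ≡ cyclicCoeff p i
    cyclicCoeff-periodic []      i k = refl
    cyclicCoeff-periodic (b ∷ p) i k = cong₂ _+_ (cong (λ r → δ₀ r * b) (ℕ%.[m+kn]%n≡m%n i k n))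
      (trans (cong (cyclicCoeff p) (ℕ+.xy∙z≈xz∙y i (k ℕ.* n) n′)) (cyclicCoeff-periodic p (i ℕ.+ n′) k))

    cyclicCoeff-shift : ∀ e p i → cyclicCoeff (shift e p) i ≡ cyclicCoeff p (i ℕ.+ e ℕ.* n′)
    cyclicCoeff-shift zero    p i = cong (cyclicCoeff p) (sym (ℕₚ.+-identityʳ i))
    cyclicCoeff-shift (suc e) p i =
      trans (cyclicCoeff-0∷ (shift e p) i) (trans (cyclicCoeff-shift e p (i ℕ.+ n′)) (cong (cyclicCoeff p) (ℕₚ.+-assoc i n′ (e ℕ.* n′))))

    cyclicCoeff-xⁿ-1 : ∀ i → cyclicCoeff (xᵉ-1 n) i ≡ 0#
    cyclicCoeff-xⁿ-1 i = begin
      cyclicCoeff (subP (monomial n) oneP) i                  ≡⟨ cyclicCoeff-addP (monomial n) (negP oneP) i ⟩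
      cyclicCoeff (monomial n) i + cyclicCoeff (negP oneP) i  ≡⟨ cong₂ _+_ xⁿ≡1 (cyclicCoeff-negP oneP i) ⟩
      cyclicCoeff oneP i + - cyclicCoeff oneP i               ≡⟨ -‿inverseʳ _ ⟩
      0#                                                      ∎
      where
      open ≡-Reasoning
      xⁿ≡1 : cyclicCoeff (monomial n) i ≡ cyclicCoeff oneP i
      xⁿ≡1 = begin
        cyclicCoeff (monomial n) i          ≡⟨ cyclicCoeff-cong i (≈-trans (≈-sym (mulP-identityʳ (monomial n))) (monomial-mulP n oneP)) ⟩
        cyclicCoeff (shift n oneP) i        ≡⟨ cyclicCoeff-shift n oneP i ⟩
        cyclicCoeff oneP (i ℕ.+ n ℕ.* n′)   ≡⟨ cong (λ m → cyclicCoeff oneP (i ℕ.+ m)) (ℕₚ.*-comm n n′) ⟩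
        cyclicCoeff oneP (i ℕ.+ n′ ℕ.* n)   ≡⟨ cyclicCoeff-periodic oneP i n′ ⟩
        cyclicCoeff oneP i                  ∎

    cyclicCoeff-multiple : ∀ k i → cyclicCoeff (mulP k (xᵉ-1 n)) i ≡ 0#
    cyclicCoeff-multiple []      i = refl
    cyclicCoeff-multiple (b ∷ k) i = begin
      cyclicCoeff (addP (scaleP b (xᵉ-1 n)) (0# ∷ mulP k (xᵉ-1 n))) i
        ≡⟨ cyclicCoeff-addP (scaleP b (xᵉ-1 n)) (0# ∷ mulP k (xᵉ-1 n)) i ⟩
      cyclicCoeff (scaleP b (xᵉ-1 n)) i + cyclicCoeff (0# ∷ mulP k (xᵉ-1 n)) i
        ≡⟨ cong₂ _+_ (trans (cyclicCoeff-scaleP b (xᵉ-1 n) i) (cong (b *_) (cyclicCoeff-xⁿ-1 i)))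
                     (trans (cyclicCoeff-0∷ (mulP k (xᵉ-1 n)) i) (cyclicCoeff-multiple k (i ℕ.+ n′))) ⟩
      b * 0# + 0#
        ≡⟨ trans (+-identityʳ _) (zeroʳ b) ⟩
      0# ∎
      where open ≡-Reasoning

    cyclicCoeff-∣xⁿ-1 : ∀ {p} → xᵉ-1 n ∣ p → ∀ i → cyclicCoeff p i ≡ 0#
    cyclicCoeff-∣xⁿ-1 (k , k[xⁿ-1]≈p) i = trans (sym (cyclicCoeff-cong i k[xⁿ-1]≈p)) (cyclicCoeff-multiple k i)

    cyclicCoeff-short : ∀ p → length p ≤ n → ∀ i → i < n → cyclicCoeff p i ≡ coeff p i
    cyclicCoeff-short []      _         i       _ = refl
    cyclicCoeff-short (b ∷ p) (s≤s p≤n′) zero    _ = begin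
      1# * b + cyclicCoeff p n′  ≡⟨ cong₂ _+_ (*-identityˡ b) (cyclicCoeff-short p p≤n n′ ℕₚ.≤-refl) ⟩
      b + coeff p n′             ≡⟨ cong (b +_) (coeff-beyond-length p n′ p≤n′) ⟩
      b + 0#                     ≡⟨ +-identityʳ b ⟩
      b                          ∎
      where
      open ≡-Reasoning
      p≤n = ℕₚ.m≤n⇒m≤1+n p≤n′
    cyclicCoeff-short (b ∷ p) (s≤s p≤n′) (suc i) (s≤s i<n′) = begin
      δ₀ (suc i % n) * b + cyclicCoeff p (suc i ℕ.+ n′)
        ≡⟨ cong₂ (λ r m → δ₀ r * b + cyclicCoeff p m) (ℕ%.m<n⇒m%n≡m (s≤s i<n′)) (sym (ℕₚ.+-suc i n′)) ⟩
      0# * b + cyclicCoeff p (i ℕ.+ n)                   ≡⟨ cong₂ _+_ (zeroˡ b) (cong (cyclicCoeff p) (cong (i ℕ.+_) (sym (ℕₚ.*-identityˡ n)))) ⟩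
      0# + cyclicCoeff p (i ℕ.+ 1 ℕ.* n)                 ≡⟨ +-identityˡ _ ⟩
      cyclicCoeff p (i ℕ.+ 1 ℕ.* n)                      ≡⟨ cyclicCoeff-periodic p i 1 ⟩
      cyclicCoeff p i                                    ≡⟨ cyclicCoeff-short p (ℕₚ.m≤n⇒m≤1+n p≤n′) i (ℕₚ.m≤n⇒m≤1+n i<n′) ⟩
      coeff p i                                          ∎
      where open ≡-Reasoning

    -- Modulo xⁿ - 1, (xᵗ - a)·C ≡ 0 says C_{j-t} = a C_j; shifting j by t gives the stated form.
    cyclicCoeff-twisted : ∀ C a t → xᵉ-1 n ∣ mulP (subP (X ^ᴾ t) [ a ]) C → ∀ j → cyclicCoeff C j ≡ a * cyclicCoeff C (t ℕ.+ j)
    cyclicCoeff-twisted C a t xⁿ-1∣[xᵗ-a]C j = begin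
      cyclicCoeff C j                              ≡⟨ cyclicCoeff-periodic C j t ⟨
      cyclicCoeff C (j ℕ.+ t ℕ.* n)                ≡⟨ cong (cyclicCoeff C) j+tn≡t+j+tn′ ⟩
      cyclicCoeff C (t ℕ.+ j ℕ.+ t ℕ.* n′)         ≡⟨ Fₚ.x∙y⁻¹≈ε⇒x≈y _ _ (difference≡0 (t ℕ.+ j)) ⟩
      a * cyclicCoeff C (t ℕ.+ j)                  ∎
      where
      open ≡-Reasoning
      j+tn≡t+j+tn′ : j ℕ.+ t ℕ.* n ≡ t ℕ.+ j ℕ.+ t ℕ.* n′
      j+tn≡t+j+tn′ = trans (cong (j ℕ.+_) (ℕₚ.*-suc t n′)) (trans (sym (ℕₚ.+-assoc j t (t ℕ.* n′))) (cong (ℕ._+ t ℕ.* n′) (ℕₚ.+-comm j t)))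
      [xᵗ-a]C≈ : mulP (subP (X ^ᴾ t) [ a ]) C ≈ subP (shift t C) (scaleP a C)
      [xᵗ-a]C≈ = ≈-trans (Polₚ.[y-z]x≈yx-zx C (X ^ᴾ t) [ a ])
        (subP-cong (≈-trans (mulP-congˡ C (≈-sym (monomial≈X^ t))) (monomial-mulP t C))
                   (≈-trans (addP-congʳ (scaleP a C) (∷-zero ≈-refl)) (addP-identityʳ (scaleP a C))))
      difference≡0 : ∀ i → cyclicCoeff C (i ℕ.+ t ℕ.* n′) + - (a * cyclicCoeff C i) ≡ 0#
      difference≡0 i = begin
        cyclicCoeff C (i ℕ.+ t ℕ.* n′) + - (a * cyclicCoeff C i)
          ≡⟨ cong₂ (λ u v → u + - v) (cyclicCoeff-shift t C i) (cyclicCoeff-scaleP a C i) ⟨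
        cyclicCoeff (shift t C) i + - cyclicCoeff (scaleP a C) i
          ≡⟨ cong (cyclicCoeff (shift t C) i +_) (cyclicCoeff-negP (scaleP a C) i) ⟨
        cyclicCoeff (shift t C) i + cyclicCoeff (negP (scaleP a C)) i
          ≡⟨ cyclicCoeff-addP (shift t C) (negP (scaleP a C)) i ⟨
        cyclicCoeff (subP (shift t C) (scaleP a C)) i
          ≡⟨ cyclicCoeff-∣xⁿ-1 (∣-respʳ [xᵗ-a]C≈ xⁿ-1∣[xᵗ-a]C) i ⟩
        0# ∎

  nonZero? : Carrier → ℕ
  nonZero? x with x ≟ 0#
  ... | yes _ = 0
  ... | no _  = 1

  nonZero?-scale : ∀ {a} x → a ≢ 0# → nonZero? (a * x) ≡ nonZero? x
  nonZero?-scale {a} x a≢0 with x ≟ 0# | (a * x) ≟ 0#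
  ... | yes _   | yes _    = refl
  ... | no _    | no _     = refl
  ... | yes x≡0 | no ax≢0  = ⊥-elim (ax≢0 (trans (cong (a *_) x≡0) (zeroʳ a)))
  ... | no x≢0  | yes ax≡0 = ⊥-elim (x≢0∧y≢0⇒x*y≢0 a≢0 x≢0 ax≡0)

  countNonZero : ℕ → (ℕ → Carrier) → ℕ
  countNonZero zero    f = 0
  countNonZero (suc k) f = nonZero? (f 0) ℕ.+ countNonZero k (f ∘ suc)

  weight≡countNonZero : ∀ {m} (v : Aₙ m) → weight v ≡ countNonZero m (coeff (toList v))
  weight≡countNonZero Vec.[]       = refl
  weight≡countNonZero (x Vec.∷ v) with x ≟ 0#
  ... | yes _ = weight≡countNonZero v
  ... | no _  = cong suc (weight≡countNonZero v)

  countNonZero-cong : ∀ k {f g} → (∀ j → j < k → nonZero? (f j) ≡ nonZero? (g j)) → countNonZero k f ≡ countNonZero k g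
  countNonZero-cong zero    _  = refl
  countNonZero-cong (suc k) f≗g = cong₂ ℕ._+_ (f≗g 0 (s≤s z≤n)) (countNonZero-cong k (λ j j<k → f≗g (suc j) (s≤s j<k)))

  countNonZero-+ : ∀ a b f → countNonZero (a ℕ.+ b) f ≡ countNonZero a f ℕ.+ countNonZero b (λ j → f (a ℕ.+ j))
  countNonZero-+ zero    b f = refl
  countNonZero-+ (suc a) b f = trans (cong (nonZero? (f 0) ℕ.+_) (countNonZero-+ a b (f ∘ suc))) (sym (ℕₚ.+-assoc (nonZero? (f 0)) _ _))

  countNonZero-periodic : ∀ t d f → (∀ j → nonZero? (f j) ≡ nonZero? (f (t ℕ.+ j))) → countNonZero (d ℕ.* t) f ≡ d ℕ.* countNonZero t f
  countNonZero-periodic t zero    f periodic = refl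
  countNonZero-periodic t (suc d) f periodic = begin
    countNonZero (t ℕ.+ d ℕ.* t) f                                      ≡⟨ countNonZero-+ t (d ℕ.* t) f ⟩
    countNonZero t f ℕ.+ countNonZero (d ℕ.* t) (λ j → f (t ℕ.+ j))
      ≡⟨ cong (countNonZero t f ℕ.+_) (countNonZero-periodic t d _ (periodic ∘ (t ℕ.+_))) ⟩
    countNonZero t f ℕ.+ d ℕ.* countNonZero t (λ j → f (t ℕ.+ j))
      ≡⟨ cong (λ m → countNonZero t f ℕ.+ d ℕ.* m) (countNonZero-cong t (λ j _ → sym (periodic j))) ⟩
    countNonZero t f ℕ.+ d ℕ.* countNonZero t f                         ∎
    where open ≡-Reasoning

  twisted⇒nonZero-periodic : ∀ (φ : ℕ → Carrier) a t → (∀ j → φ j ≡ a * φ (t ℕ.+ j)) → ∀ j → nonZero? (φ j) ≡ nonZero? (φ (t ℕ.+ j))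
  twisted⇒nonZero-periodic φ a t twisted j with a ≟ 0#
  ... | yes a≡0 = cong nonZero? (trans (φ≡0 j) (sym (φ≡0 (t ℕ.+ j))))
    where
    φ≡0 : ∀ i → φ i ≡ 0#
    φ≡0 i = trans (twisted i) (trans (cong (_* φ (t ℕ.+ i)) a≡0) (zeroˡ _))
  ... | no a≢0  = trans (cong nonZero? (twisted j)) (nonZero?-scale (φ (t ℕ.+ j)) a≢0)

  ideal-annihilated : ∀ {g h D U C a′} → mulP g h ≈ D → h ∣ U → D ∣ subP (mulP a′ g) C → D ∣ mulP U C
  ideal-annihilated {g} {h} {D} {U} {C} {a′} gh≈D (k , kh≈U) D∣a′g-C =
    ∣-respʳ Ua′g-U[a′g-C]≈UC (∣-subP D∣Ua′g (∣-mulP U D∣a′g-C))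
    where
    D∣Ua′g : D ∣ mulP U (mulP a′ g)
    D∣Ua′g = mulP a′ k , ≈-trans (mulP-congʳ (mulP a′ k) (≈-sym gh≈D))
      (≈-trans (solveᴾ 4 (λ a k g h → (a ⊗ k) ⊗ (g ⊗ h) ⊜ (k ⊗ h) ⊗ (a ⊗ g)) ≈-refl a′ k g h) (mulP-congˡ (mulP a′ g) kh≈U))
    Ua′g-U[a′g-C]≈UC : subP (mulP U (mulP a′ g)) (mulP U (subP (mulP a′ g) C)) ≈ mulP U C
    Ua′g-U[a′g-C]≈UC = begin
      subP A (mulP U (subP (mulP a′ g) C))  ≈⟨ addP-congʳ A (negP-cong (Polₚ.x[y-z]≈xy-xz U (mulP a′ g) C)) ⟩
      subP A (subP A B)                     ≈⟨ addP-congʳ A (Polₚ.⁻¹-anti-homo‿- A B) ⟩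
      addP A (subP B A)                     ≈⟨ addP-assoc A B (negP A) ⟨
      addP (addP A B) (negP A)              ≈⟨ Polₚ.xyx⁻¹≈y A B ⟩
      B                                     ∎
      where
      open ≈-Reasoning
      A = mulP U (mulP a′ g)
      B = mulP U C

  weight-twisted : ∀ {n′} (c : Aₙ (suc n′)) a t d → suc n′ ≡ d ℕ.* t →
    (∀ j → Cyclic.cyclicCoeff n′ (toList c) j ≡ a * Cyclic.cyclicCoeff n′ (toList c) (t ℕ.+ j)) → d ℕᵈ.∣ weight c
  weight-twisted {n′} c a t d n≡dt twisted = ℕᵈ.divides (countNonZero t φ) (begin
    weight c                         ≡⟨ weight≡countNonZero c ⟩
    countNonZero n (coeff (toList c)) ≡⟨ countNonZero-cong n (λ j j<n → cong nonZero? (sym (cyclicCoeff-short (toList c) |c|≤n j j<n))) ⟩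
    countNonZero n φ                 ≡⟨ cong (λ m → countNonZero m φ) n≡dt ⟩
    countNonZero (d ℕ.* t) φ         ≡⟨ countNonZero-periodic t d φ (twisted⇒nonZero-periodic φ a t twisted) ⟩
    d ℕ.* countNonZero t φ           ≡⟨ ℕₚ.*-comm d _ ⟩
    countNonZero t φ ℕ.* d           ∎)
    where
    open ≡-Reasoning
    open Cyclic n′
    φ = cyclicCoeff (toList c)
    |c|≤n : length (toList c) ≤ n
    |c|≤n = ℕₚ.≤-reflexive (Vecₚ.length-toList c)

  gcd[q-1,n]∣weight : ∀ n h g → Irreducible h → mulP g h ≈ₚ xᵉ-1 n → (c : Aₙ n) → InIdeal n g c → gcd (q ∸ 1) n ℕᵈ.∣ weight c
  gcd[q-1,n]∣weight zero     h g h-irr gh≈xⁿ-1 Vec.[] c∈⟨g⟩ = gcd (q ∸ 1) 0 ℕᵈ.∣0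
  gcd[q-1,n]∣weight (suc n′) h g h-irr gh≈xⁿ-1 c (a′ , k , k[xⁿ-1]≈a′g-c) =
    weight-twisted c a t d (trans n≡td (ℕₚ.*-comm t d)) (Cyclic.cyclicCoeff-twisted n′ (toList c) a t xⁿ-1∣[xᵗ-a]c)
    where
    n = suc n′
    d = gcd (q ∸ 1) n
    t = ℕᵈ.quotient (gcd[m,n]∣n (q ∸ 1) n)
    s = ℕᵈ.quotient (gcd[m,n]∣m (q ∸ 1) n)
    n≡td : n ≡ t ℕ.* d
    n≡td = ℕᵈ._∣_.equality (gcd[m,n]∣n (q ∸ 1) n)
    t[q-1]≡sn : t ℕ.* (q ∸ 1) ≡ s ℕ.* n
    t[q-1]≡sn = begin
      t ℕ.* (q ∸ 1)      ≡⟨ cong (t ℕ.*_) (ℕᵈ._∣_.equality (gcd[m,n]∣m (q ∸ 1) n)) ⟩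
      t ℕ.* (s ℕ.* d)    ≡⟨ ℕ*.x∙yz≈y∙xz t s d ⟩
      s ℕ.* (t ℕ.* d)    ≡⟨ cong (s ℕ.*_) n≡td ⟨
      s ℕ.* n            ∎
      where open ≡-Reasoning
    gh≈xⁿ-1′ : mulP g h ≈ xᵉ-1 n
    gh≈xⁿ-1′ = coeffwise gh≈xⁿ-1
    h-root : Σ Carrier λ a → h ∣ subP (X ^ᴾ t) [ a ]
    h-root = irreducible-∣yᵠ-y h-irr (X ^ᴾ t) (∣xⁿ-1⇒∣yᵠ-y {t = t} {s = s} (g , gh≈xⁿ-1′) t[q-1]≡sn)
    a = proj₁ h-root
    xⁿ-1∣[xᵗ-a]c : xᵉ-1 n ∣ mulP (subP (X ^ᴾ t) [ a ]) (toList c)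
    xⁿ-1∣[xᵗ-a]c = ideal-annihilated {C = toList c} {a′ = a′} gh≈xⁿ-1′ (proj₂ h-root) (k , coeffwise {mulP k (xᵉ-1 n)} k[xⁿ-1]≈a′g-c)

open import Data.Nat using (_^_)
open import Data.Nat.Divisibility using (_∣_)
open import Data.Nat.Coprimality using (Coprime)

corollary6 : (q : ℕ) → IsPrimePower q → 2 < q → (F : FiniteField q) →
    let open Poly F in
    (n m : ℕ) (h g : Pol) →
    Irreducible h → HasDegree h m → HasOrder h n →
    Coprime n q → n ≢ q ^ m ∸ 1 →
    mulP g h ≈ₚ xᵉ-1 n →
    (c : Aₙ n) → InIdeal n g c →
    gcd (q ∸ 1) n ∣ weight c
corollary6 q _ _ F n _ h g h-irreducible _ _ _ _ gh≈xⁿ-1 =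
  IrreducibleCyclicCodes.gcd[q-1,n]∣weight F n h g h-irreducible gh≈xⁿ-1
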